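{- Let $N$ be a tree-based phylogenetic network on $X$ and let $\mathcal{Z}=\{Z_1,\dots,Z_\ell\}$ be its decomposition into maximal zig-zag trails. For each $i$ let $m_i=|A(Z_i)|$ and fix an ordering $(a^i_1,\dots,a^i_{m_i})$ of $A(Z_i)$ in which consecutive arcs form the zig-zag trail in this order (for a fence, starting at one endpoint and ending at the other; for a crown, starting at any arc and going around). For $A\subseteq A(N)$ let $\chi_i(A)=\langle x_1\cdots x_{m_i}\rangle$ be the 0-1 sequence with $x_j=1$ iff $a^i_j\in A$. Define $$\mathcal{S}(Z_i)=\begin{cases}\{\langle(10)^{m_i/2}\rangle,\ \langle(01)^{m_i/2}\rangle\} & \text{if } Z_i \text{ is a crown},\\ \{\langle 1(01)^{(m_i-1)/2}\rangle\} & \text{if } Z_i \text{ is an N-fence},\\ \{\langle 1(01)^p(10)^q1\rangle : p,q\in\mathbb{Z}_{\ge0},\ p+q=(m_i-2)/2\} & \text{if } Z_i \text{ is an M-fence}.\end{cases}$$ Then the set $\mathcal{T}$ of subdivision trees of $N$ satisfies $\mathcal{T}=\prod_{i\in[1,\ell]}\mathcal{S}(Z_i)$; that is, a set $A\subseteq A(N)$ is the arc set of a subdivision tree of $N$ if and only if $\chi_i(A)\in\mathcal{S}(Z_i)$ for every $i\in[1,\ell]$, and the map sending a subdivision tree $T$ to $(\chi_1(A(T)),\dots,\chi_\ell(A(T)))$ is a bijection from $\mathcal{T}$ onto $\prod_{i}\mathcal{S}(Z_i)$.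
   Context: All digraphs are finite, simple and acyclic; ${\it deg}^-_N,{\it deg}^+_N$ denote in- and out-degree. A leaf has in-degree $1$ and out-degree $0$. A rooted binary phylogenetic $X$-network ($X$ non-empty finite) is a finite simple acyclic digraph $N$ with a unique vertex $\rho$ of in-degree $0$ (of out-degree $1$ or $2$), leaf set $X$, and every other vertex $v$ satisfying $\{{\it deg}^-_N(v),{\it deg}^+_N(v)\}=\{1,2\}$; with no vertex of in-degree $2$ it is a rooted binary phylogenetic $X$-tree. A subdivision of a digraph is obtained by repeatedly replacing an arc $(u,v)$ by a new vertex $x$ and arcs $(u,x),(x,v)$. A subdivision tree of $N$ is a spanning subgraph of $N$ that is a subdivision of a rooted binary phylogenetic $X$-tree (it is determined by its arc set); $N$ is a tree-based phylogenetic network on $X$ if it has at least one subdivision tree. A zig-zag trail in $N$ is a connected subgraph $Z$ with $|A(Z)|\ge1$ whose arcs admit an ordering in which consecutive arcs share a head or share a tail; it is maximal if not a proper subgraph of another zig-zag trail. The decomposition into maximal zig-zag trails is the unique family of maximal zig-zag trails whose arc sets partition $A(N)$. Notation: $u>v$ (equivalently $v<u$) means $(u,v)$ is an arc. With $m=|A(Z)|$: $Z$ is a crown if $m\ge4$ is even and $Z$ can be written $v_0<v_1>v_2<\cdots<v_{m-1}>v_m=v_0$; otherwise a fence. An N-fence is a fence with $m$ odd, $v_0>v_1<v_2>\cdots<v_{m-1}>v_m$; a W-fence has $m\ge2$ even and form $v_0>v_1<\cdots>v_{m-1}<v_m$; an M-fence has $m\ge2$ even and form $v_0<v_1>v_2<\cdots<v_{m-1}>v_m$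 (both end arcs have their heads at the endpoints). In a 0-1 sequence, $(w)^k$ denotes $k$ consecutive copies of the word $w$. -}

module Defs where

open import Data.Nat using (ℕ; zero; suc; _+_; _∸_; _≤_; _/_; _%_)
open import Data.Fin using (Fin; zero; suc; inject₁; fromℕ; toℕ; _≟_)
open import Data.Bool using (Bool; true; false; _∧_; not; if_then_else_)
open import Data.Product using (Σ; Σ-syntax; _×_; _,_; proj₁; proj₂)
open import Data.Sum using (_⊎_)
open import Data.List using (List; []; _∷_; _++_; tabulate; concat; replicate)
open import Data.List.Membership.Propositional using (_∈_)
open import Data.List.Relation.Unary.Unique.Propositional using (Unique)
open import Data.List.Relation.Unary.Linked using (Linked)
open import Relation.Binary.PropositionalEquality using (_≡_)
open import Relation.Nullary using (¬_)
open import Relation.Nullary.Decidable using (⌊_⌋)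
open import Function using (_⇔_)

-- Digraphs: vertex set Fin V, arc relation E (Bool-valued, so there
-- are no parallel arcs; loops are excluded by acyclicity).

record Digraph : Set where
  field
    V : ℕ
    E : Fin V → Fin V → Bool
open Digraph public

Arc : (G : Digraph) → Fin (V G) → Fin (V G) → Set
Arc G u v = E G u v ≡ true

count : ∀ {k} → (Fin k → Bool) → ℕ
count {zero} p = 0
count {suc k} p = (if p zero then 1 else 0) + count (λ i → p (suc i))

indeg : (G : Digraph) → Fin (V G) → ℕ
indeg G v = count (λ u → E G u v)

outdeg : (G : Digraph) → Fin (V G) → ℕ
outdeg G v = count (λ w → E G v w)

data Reach (G : Digraph) : Fin (V G) → Fin (V G) → Set where
  one  : ∀ {u v} → Arc G u v → Reach G u v
  more : ∀ {u w v} → Arc G u w → Reach G w v → Reach G u v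

Acyclic : Digraph → Set
Acyclic G = ∀ v → ¬ Reach G v v

IsLeaf : (G : Digraph) → Fin (V G) → Set
IsLeaf G v = indeg G v ≡ 1 × outdeg G v ≡ 0

-- Rooted binary phylogenetic network; its leaf set is X (non-empty).
IsRootedBinaryPhyloNetwork : Digraph → Set
IsRootedBinaryPhyloNetwork G =
  Acyclic G ×
  (Σ[ ρ ∈ Fin (V G) ]
     indeg G ρ ≡ 0 × (outdeg G ρ ≡ 1 ⊎ outdeg G ρ ≡ 2) ×
     (∀ v → indeg G v ≡ 0 → v ≡ ρ) ×
     (∀ v → ¬ v ≡ ρ →
        IsLeaf G v
        ⊎ (indeg G v ≡ 1 × outdeg G v ≡ 2)
        ⊎ (indeg G v ≡ 2 × outdeg G v ≡ 1))) ×
  (Σ[ x ∈ Fin (V G) ] IsLeaf G x)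

IsRootedBinaryPhyloTree : Digraph → Set
IsRootedBinaryPhyloTree G =
  IsRootedBinaryPhyloNetwork G × (∀ v → ¬ indeg G v ≡ 2)

-- replace arc (u,v) by a new vertex x (= zero) and arcs (u,x),(x,v)
subdivide : (G : Digraph) → Fin (V G) → Fin (V G) → Digraph
subdivide G u v = record { V = suc (V G) ; E = e }
  where
  e : Fin (suc (V G)) → Fin (suc (V G)) → Bool
  e zero    zero    = false
  e zero    (suc y) = ⌊ y ≟ v ⌋
  e (suc x) zero    = ⌊ x ≟ u ⌋
  e (suc x) (suc y) = E G x y ∧ not (⌊ x ≟ u ⌋ ∧ ⌊ y ≟ v ⌋)

data SubdivSteps (G : Digraph) : Digraph → Set where
  base : SubdivSteps G G
  step : ∀ {H} → SubdivSteps G H → (u v : Fin (V H)) → Arc H u v →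
         SubdivSteps G (subdivide H u v)

record _≅_ (G H : Digraph) : Set where
  field
    to      : Fin (V G) → Fin (V H)
    from    : Fin (V H) → Fin (V G)
    from-to : ∀ x → from (to x) ≡ x
    to-from : ∀ y → to (from y) ≡ y
    arcs    : ∀ x y → E G x y ≡ E H (to x) (to y)

IsSubdivisionOf : Digraph → Digraph → Set
IsSubdivisionOf H G = Σ[ H' ∈ Digraph ] SubdivSteps G H' × H' ≅ H

ArcSet : Digraph → Set
ArcSet N = Fin (V N) → Fin (V N) → Bool

SubArcs : (N : Digraph) → ArcSet N → ArcSet N → Set
SubArcs N A B = ∀ u v → A u v ≡ true → B u v ≡ true

spanning : (N : Digraph) → ArcSet N → Digraph
spanning N A = record { V = V N ; E = A }

-- A is the arc set of a subdivision tree of N: the spanning subgraph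
-- with arc set A is a subdivision of a rooted binary phylogenetic tree
-- whose leaf set is X (= leaf set of N).
IsSubdivisionTree : (N : Digraph) → ArcSet N → Set
IsSubdivisionTree N A =
  SubArcs N A (E N) ×
  (Σ[ T ∈ Digraph ] IsRootedBinaryPhyloTree T × IsSubdivisionOf (spanning N A) T) ×
  (∀ v → IsLeaf (spanning N A) v ⇔ IsLeaf N v)

IsTreeBased : Digraph → Set
IsTreeBased N = IsRootedBinaryPhyloNetwork N × Σ[ A ∈ ArcSet N ] IsSubdivisionTree N A

ShareEnd : ∀ {n} → Fin n × Fin n → Fin n × Fin n → Set
ShareEnd (u , v) (u' , v') = v ≡ v' ⊎ u ≡ u'

IsZigZagTrail : (N : Digraph) → ArcSet N → Set
IsZigZagTrail N B =
  SubArcs N B (E N) ×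
  Σ[ ord ∈ List (Fin (V N) × Fin (V N)) ]
    ¬ ord ≡ [] × Unique ord ×
    (∀ u v → (B u v ≡ true ⇔ (u , v) ∈ ord)) ×
    Linked ShareEnd ord

IsMaximalZigZagTrail : (N : Digraph) → ArcSet N → Set
IsMaximalZigZagTrail N B =
  IsZigZagTrail N B ×
  (∀ B' → IsZigZagTrail N B' → SubArcs N B B' → SubArcs N B' B)

-- alternating walks v_0 ... v_m; d = true means v_0 > v_1 (arc (v_0,v_1))
alt : Bool → ℕ → Bool
alt d zero    = d
alt d (suc k) = alt (not d) k

walkArc : ∀ {n m} → Bool → (Fin (suc m) → Fin n) → Fin m → Fin n × Fin n
walkArc d v j =
  if alt d (toℕ j) then (v (inject₁ j) , v (suc j)) else (v (suc j) , v (inject₁ j))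

Enumerates : (N : Digraph) → ArcSet N → ∀ {m} → (Fin m → Fin (V N) × Fin (V N)) → Set
Enumerates N B {m} a =
  (∀ j k → a j ≡ a k → j ≡ k) ×
  (∀ u v → (B u v ≡ true ⇔ (Σ[ j ∈ Fin m ] a j ≡ (u , v))))

-- v_0 < v_1 > v_2 < ... < v_{m-1} > v_m = v_0, m ≥ 4 even
IsCrown : (N : Digraph) → ArcSet N → Set
IsCrown N B =
  Σ[ m ∈ ℕ ] Σ[ v ∈ (Fin (suc m) → Fin (V N)) ]
    4 ≤ m × m % 2 ≡ 0 × v (fromℕ m) ≡ v zero × Enumerates N B (walkArc false v)

-- v_0 > v_1 < v_2 > ... < v_{m-1} > v_m, m odd
IsNFence : (N : Digraph) → ArcSet N → Set
IsNFence N B =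
  ¬ IsCrown N B ×
  Σ[ m ∈ ℕ ] Σ[ v ∈ (Fin (suc m) → Fin (V N)) ]
    m % 2 ≡ 1 × Enumerates N B (walkArc true v)

-- v_0 > v_1 < ... > v_{m-1} < v_m, m ≥ 2 even
IsWFence : (N : Digraph) → ArcSet N → Set
IsWFence N B =
  ¬ IsCrown N B ×
  Σ[ m ∈ ℕ ] Σ[ v ∈ (Fin (suc m) → Fin (V N)) ]
    2 ≤ m × m % 2 ≡ 0 × Enumerates N B (walkArc true v)

-- v_0 < v_1 > ... < v_{m-1} > v_m, m ≥ 2 even
IsMFence : (N : Digraph) → ArcSet N → Set
IsMFence N B =
  ¬ IsCrown N B ×
  Σ[ m ∈ ℕ ] Σ[ v ∈ (Fin (suc m) → Fin (V N)) ]
    2 ≤ m × m % 2 ≡ 0 × Enumerates N B (walkArc false v)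

record MaxZZDecomposition (N : Digraph) : Set where
  field
    ℓ         : ℕ
    trail     : Fin ℓ → ArcSet N
    maximal   : ∀ i → IsMaximalZigZagTrail N (trail i)
    partition : ∀ u v → Arc N u v →
                Σ[ i ∈ Fin ℓ ] trail i u v ≡ true × (∀ j → trail j u v ≡ true → j ≡ i)
open MaxZZDecomposition public

-- ordering of A(Z_i) along the trail, given by an alternating vertex walk
record TrailOrderings (N : Digraph) (D : MaxZZDecomposition N) : Set where
  field
    len  : Fin (ℓ D) → ℕ
    dir  : Fin (ℓ D) → Bool
    walk : (i : Fin (ℓ D)) → Fin (suc (len i)) → Fin (V N)
    enum : ∀ i → Enumerates N (trail D i) (walkArc (dir i) (walk i))
open TrailOrderings public

ordArc : ∀ {N D} (O : TrailOrderings N D) (i : Fin (ℓ D)) → Fin (len O i) → Fin (V N) × Fin (V N)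
ordArc O i = walkArc (dir O i) (walk O i)

χ : ∀ {N D} (O : TrailOrderings N D) (i : Fin (ℓ D)) → ArcSet N → List Bool
χ O i A = tabulate (λ j → A (proj₁ (ordArc O i j)) (proj₂ (ordArc O i j)))

rep : ℕ → List Bool → List Bool
rep k w = concat (replicate k w)

-- s ∈ S(Z) where m = |A(Z)|  (S(Z) is empty for W-fences)
InS : (N : Digraph) → ArcSet N → ℕ → List Bool → Set
InS N Z m s =
  (IsCrown N Z ×
     (s ≡ rep (m / 2) (true ∷ false ∷ []) ⊎ s ≡ rep (m / 2) (false ∷ true ∷ [])))
  ⊎ (IsNFence N Z × s ≡ true ∷ rep ((m ∸ 1) / 2) (false ∷ true ∷ []))
  ⊎ (IsMFence N Z ×
       Σ[ p ∈ ℕ ] Σ[ q ∈ ℕ ] p + q ≡ (m ∸ 2) / 2 ×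
         s ≡ true ∷ (rep p (false ∷ true ∷ []) ++ rep q (true ∷ false ∷ []) ++ true ∷ []))

-- A set A of arcs of a binary network is a subdivision tree exactly when it satisfies the
-- local conditions of a tree: every non-root vertex keeps exactly one incoming arc and every
-- non-leaf keeps an outgoing one (suppressing the vertices of in- and out-degree one of such a
-- subgraph leaves a binary tree, while subdivision preserves these degree conditions).
-- Arcs with a common head, or a common tail, lie on a common maximal zig-zag trail, so the
-- local conditions split over the trails.  Along a trail they only compare consecutive bits
-- of χ_i(A): at a common head exactly one of the two arcs is chosen, at a common tail at
-- least one, and at an endpoint of degree one its arc is chosen.  Propagating these
-- constraints along a crown, an N-fence and an M-fence gives exactly the sequences of
-- S(Z_i); on a W-fence they are contradictory.  Since the trails partition the arcs, χ
-- determines A, and every choice of sequences is realised.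

module Submission where

open import Defs
open import Data.Fin using (Fin)
open import Data.List using (List)
open import Data.Bool using (Bool)
open import Data.Product using (Σ; Σ-syntax; _×_)
open import Relation.Binary.PropositionalEquality using (_≡_)
open import Function using (_⇔_)

open import Algebra.Properties.CommutativeMonoid.Sum using (sum; sum-permute)
open import Data.Bool using (true; false; _∧_; _∨_; not; if_then_else_)
open import Data.Bool.Properties using (not-involutive; ¬-not; ∧-zeroʳ; ∧-identityʳ; ∨-zeroʳ; ∨-identityʳ) renaming (_≟_ to _B≟_)
open import Data.Empty using (⊥; ⊥-elim)
open import Data.Fin as F using (zero; suc; toℕ; inject₁; fromℕ; fromℕ<; punchIn; punchOut; _≟_)
open import Data.Fin.Permutation using (permutation)
open import Data.Fin.Properties using (punchInᵢ≢i; punchIn-punchOut; punchIn-injective; toℕ<n; toℕ-inject₁; toℕ-fromℕ; toℕ-fromℕ<; toℕ-injective; injective⇒≤; any?)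
open import Data.List using ([]; _∷_; _++_; length; tabulate)
open import Data.List.Membership.Propositional using (_∈_)
open import Data.List.Properties using (∷-injective; tabulate-cong)
open import Data.List.Relation.Unary.All using (All; []; _∷_)
open import Data.List.Relation.Unary.AllPairs using (AllPairs; []; _∷_)
open import Data.List.Relation.Unary.Any using (here; there)
open import Data.List.Relation.Unary.Linked using (Linked; []; [-]; _∷_)
open import Data.Nat as ℕ using (ℕ; zero; suc; _+_; _∸_; _≤_; _<_; z≤n; s≤s; s≤s⁻¹; _/_; _%_; _≤?_; _<?_)
open import Data.Nat.DivMod using (m/n≡1+[m∸n]/n; [m+n]%n≡m%n)
open import Data.Nat.Properties hiding (_≟_)
open import Data.Nat.Solver using (module +-*-Solver)
open import Algebra.Properties.CommutativeSemigroup +-commutativeSemigroup using (x∙yz≈y∙xz)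
open import Data.Product using (_,_; proj₁; proj₂)
open import Data.Product.Properties using (≡-dec)
open import Data.Sum using (_⊎_; inj₁; inj₂)
open import Function using (_∘_; mk⇔)
open import Function.Bundles using (Equivalence)
open import Relation.Binary.PropositionalEquality using (refl; sym; trans; cong; cong₂; subst; subst₂)
open import Relation.Nullary using (¬_; Dec; yes; no; ¬?)
open import Relation.Nullary.Decidable using (⌊_⌋; _×-dec_)

module Counting where

  b2n : Bool → ℕ
  b2n b = if b then 1 else 0

  count-cong : ∀ {k} (f g : Fin k → Bool) → (∀ x → f x ≡ g x) → count f ≡ count g
  count-cong {zero} f g e = refl
  count-cong {suc k} f g e rewrite e zero = cong (b2n (g zero) +_) (count-cong (f ∘ suc) (g ∘ suc) (e ∘ suc))

  count-punchIn : ∀ {n} (f : Fin (suc n) → Bool) (x : Fin (suc n)) →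
    count f ≡ b2n (f x) + count (f ∘ punchIn x)
  count-punchIn f zero = refl
  count-punchIn {suc n} f (suc x) =
    trans (cong (b2n (f zero) +_) (count-punchIn (f ∘ suc) x)) (x∙yz≈y∙xz (b2n (f zero)) (b2n (f (suc x))) _)

  count-none : ∀ {k} (f : Fin k → Bool) → (∀ x → f x ≡ false) → count f ≡ 0
  count-none {zero} f e = refl
  count-none {suc k} f e rewrite e zero = count-none (f ∘ suc) (e ∘ suc)

  count-mono : ∀ {k} (g f : Fin k → Bool) → (∀ x → g x ≡ true → f x ≡ true) → count g ≤ count f
  count-mono {zero} g f h = z≤n
  count-mono {suc k} g f h with g zero in eg | f zero in ef
  ... | true | true = s≤s (count-mono (g ∘ suc) (f ∘ suc) (h ∘ suc))
  ... | true | false with () ← trans (sym (h zero eg)) ef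
  ... | false | true = ≤-trans (count-mono (g ∘ suc) (f ∘ suc) (h ∘ suc)) (n≤1+n _)
  ... | false | false = count-mono (g ∘ suc) (f ∘ suc) (h ∘ suc)

  count-≥1 : ∀ {k} (f : Fin k → Bool) x → f x ≡ true → 1 ≤ count f
  count-≥1 {suc k} f x e rewrite count-punchIn f x | e = s≤s z≤n

  count-witness : ∀ {k} (f : Fin k → Bool) → 1 ≤ count f → Σ (Fin k) λ x → f x ≡ true
  count-witness {suc k} f c with f zero in e
  ... | true = zero , e
  ... | false with count-witness (f ∘ suc) c
  ... | x , ex = suc x , ex

  punchIn-cover : ∀ {n} (x y : Fin (suc n)) → ¬ y ≡ x → Σ (Fin n) λ a → punchIn x a ≡ y
  punchIn-cover x y ne = punchOut (λ e → ne (sym e)) , punchIn-punchOut _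

  count-single : ∀ {k} (g f : Fin k → Bool) x → (∀ y → g y ≡ true → f y ≡ true) →
    (∀ y → f y ≡ true → y ≡ x) → count g ≡ b2n (g x)
  count-single {suc k} g f x sub ex =
    trans (count-punchIn g x) (trans (cong (b2n (g x) +_) (count-none (g ∘ punchIn x) off-x)) (+-identityʳ _))
    where
    off-x : ∀ a → g (punchIn x a) ≡ false
    off-x a with g (punchIn x a) in e
    ... | false = refl
    ... | true = ⊥-elim (punchInᵢ≢i x a (ex _ (sub _ e)))

  count-pair : ∀ {k} (g f : Fin k → Bool) x y → ¬ x ≡ y → (∀ z → g z ≡ true → f z ≡ true) →
    (∀ z → f z ≡ true → z ≡ x ⊎ z ≡ y) → count g ≡ b2n (g x) + b2n (g y)
  count-pair {suc k} g f x y ne sub ex with punchIn-cover x y (λ e → ne (sym e))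
  ... | y' , ey' = trans (count-punchIn g x) (cong (b2n (g x) +_)
     (trans (count-single (g ∘ punchIn x) (f ∘ punchIn x) y' (λ z → sub _) off-x) (cong (λ t → b2n (g t)) ey')))
    where
    off-x : ∀ z → f (punchIn x z) ≡ true → z ≡ y'
    off-x z e with ex _ e
    ... | inj₁ p = ⊥-elim (punchInᵢ≢i x z p)
    ... | inj₂ p = punchIn-injective x z y' (trans p (sym ey'))

  count-witness₂ : ∀ {k} (f : Fin k → Bool) x → 2 ≤ count f → f x ≡ true →
    Σ (Fin k) λ y → ¬ y ≡ x × f y ≡ true
  count-witness₂ {suc k} f x c e rewrite count-punchIn f x | e with count-witness (f ∘ punchIn x) (s≤s⁻¹ c)
  ... | a , ea = punchIn x a , punchInᵢ≢i x a , ea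

  count-≥2 : ∀ {k} (f : Fin k → Bool) x y → ¬ x ≡ y → f x ≡ true → f y ≡ true → 2 ≤ count f
  count-≥2 {suc k} f x y nxy ex ey with punchIn-cover x y (λ e → nxy (sym e))
  ... | y' , ey' rewrite count-punchIn f x | ex =
    s≤s (count-≥1 (f ∘ punchIn x) y' (trans (cong f ey') ey))

  count-≥3 : ∀ {k} (f : Fin k → Bool) x y z → ¬ x ≡ y → ¬ x ≡ z → ¬ y ≡ z →
    f x ≡ true → f y ≡ true → f z ≡ true → 3 ≤ count f
  count-≥3 {suc k} f x y z nxy nxz nyz ex ey ez
    with punchIn-cover x y (λ e → nxy (sym e)) | punchIn-cover x z (λ e → nxz (sym e))
  ... | y' , ey' | z' , ez' rewrite count-punchIn f x | ex =
    s≤s (count-≥2 (f ∘ punchIn x) y' z' (λ e → nyz (trans (sym ey') (trans (cong (punchIn x) e) ez')))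
          (trans (cong f ey') ey) (trans (cong f ez') ez))

  count≡1-unique : ∀ {k} (f : Fin k → Bool) → count f ≡ 1 → ∀ a b → f a ≡ true → f b ≡ true → a ≡ b
  count≡1-unique f c a b fa fb with a ≟ b
  ... | yes e = e
  ... | no ne with s≤s () ← ≤-trans (count-≥2 f a b ne fa fb) (≤-reflexive c)

  count≡sum : ∀ {k} (f : Fin k → Bool) → count f ≡ sum +-0-commutativeMonoid (b2n ∘ f)
  count≡sum {zero} f = refl
  count≡sum {suc k} f = cong (b2n (f zero) +_) (count≡sum (f ∘ suc))

  count-permute : ∀ {k k'} (f : Fin k → Bool) (to : Fin k' → Fin k) (from : Fin k → Fin k') →
    (∀ y → to (from y) ≡ y) → (∀ x → from (to x) ≡ x) → count f ≡ count (f ∘ to)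
  count-permute f to from tf ft =
    trans (count≡sum f) (trans (sum-permute +-0-commutativeMonoid (b2n ∘ f) (permutation to from tf ft)) (sym (count≡sum (f ∘ to))))

  eqb : ∀ {n} → Fin n → Fin n → Bool
  eqb x y = ⌊ x ≟ y ⌋

  eqb-refl : ∀ {n} (x : Fin n) → eqb x x ≡ true
  eqb-refl x with x ≟ x
  ... | yes _ = refl
  ... | no ne = ⊥-elim (ne refl)

  eqb-no : ∀ {n} {x y : Fin n} → ¬ x ≡ y → eqb x y ≡ false
  eqb-no {x = x} {y} ne with x ≟ y
  ... | yes e = ⊥-elim (ne e)
  ... | no _ = refl

  eqb-true : ∀ {n} {x y : Fin n} → eqb x y ≡ true → x ≡ y
  eqb-true {x = x} {y} e with x ≟ y
  ... | yes p = p

  eqb-injective : ∀ {m n} (f : Fin m → Fin n) → (∀ a b → f a ≡ f b → a ≡ b) →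
    ∀ x u → eqb x u ≡ eqb (f x) (f u)
  eqb-injective f inj x u with x ≟ u | f x ≟ f u
  ... | yes e | yes _ = refl
  ... | yes refl | no ne = ⊥-elim (ne refl)
  ... | no ne | yes e = ⊥-elim (ne (inj _ _ e))
  ... | no _ | no _ = refl

  count-eqb : ∀ {n} (v : Fin n) → count (λ y → eqb y v) ≡ 1
  count-eqb v = trans (count-single (λ y → eqb y v) (λ y → eqb y v) v (λ _ e → e) (λ _ → eqb-true))
    (cong b2n (eqb-refl v))

  count-remove : ∀ {k} (f : Fin k → Bool) u → f u ≡ true →
    count f ≡ suc (count (λ x → f x ∧ not (eqb x u)))
  count-remove {suc k} f u fu =
    trans (count-punchIn f u) (trans (cong (λ b → b2n b + count (f ∘ punchIn u)) fu)
     (cong suc (sym (trans (count-punchIn g u) (trans (cong (λ b → b2n b + count (g ∘ punchIn u)) gu)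
       (count-cong _ _ λ a → trans (cong (λ b → f (punchIn u a) ∧ not b) (eqb-no (punchInᵢ≢i u a)))
           (∧-identityʳ _)))))))
    where
    g : Fin (suc k) → Bool
    g x = f x ∧ not (eqb x u)
    gu : g u ≡ false
    gu = trans (cong (λ b → f u ∧ not b) (eqb-refl u)) (∧-zeroʳ (f u))

  count-add : ∀ {k} (f : Fin k → Bool) c → f c ≡ false → count (λ y → f y ∨ eqb y c) ≡ suc (count f)
  count-add f c fc =
    trans (count-remove (λ y → f y ∨ eqb y c) c (trans (cong (f c ∨_) (eqb-refl c)) (∨-zeroʳ _)))
     (cong suc (count-cong _ _ removed))
    where
    removed : ∀ y → (f y ∨ eqb y c) ∧ not (eqb y c) ≡ f y
    removed y with y ≟ c
    ... | yes refl = trans (∧-zeroʳ _) (sym fc)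
    ... | no _ = trans (∧-identityʳ _) (∨-identityʳ _)


module Isomorphism where

  open Counting
  open _≅_

  ≅-refl : ∀ G → G ≅ G
  ≅-refl G = record { to = λ x → x ; from = λ x → x ; from-to = λ _ → refl ; to-from = λ _ → refl ; arcs = λ _ _ → refl }

  ≅-trans : ∀ {G H K} → G ≅ H → H ≅ K → G ≅ K
  ≅-trans φ ψ = record
    { to = λ x → to ψ (to φ x) ; from = λ y → from φ (from ψ y)
    ; from-to = λ x → trans (cong (from φ) (from-to ψ (to φ x))) (from-to φ x)
    ; to-from = λ y → trans (cong (to ψ) (to-from φ (from ψ y))) (to-from ψ y)
    ; arcs = λ x y → trans (arcs φ x y) (arcs ψ (to φ x) (to φ y)) }

  ≅-indeg : ∀ {G H} (φ : G ≅ H) x → indeg H (to φ x) ≡ indeg G x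
  ≅-indeg {G} {H} φ x =
    trans (count-permute (λ u → E H u (to φ x)) (to φ) (from φ) (to-from φ) (from-to φ))
          (count-cong _ _ λ u → sym (arcs φ u x))

  ≅-outdeg : ∀ {G H} (φ : G ≅ H) x → outdeg H (to φ x) ≡ outdeg G x
  ≅-outdeg {G} {H} φ x =
    trans (count-permute (λ u → E H (to φ x) u) (to φ) (from φ) (to-from φ) (from-to φ))
          (count-cong _ _ λ u → sym (arcs φ x u))

  subdivide-≅ : ∀ {H G} (φ : H ≅ G) u v p c → to φ u ≡ p → to φ v ≡ c →
    subdivide H u v ≅ subdivide G p c
  subdivide-≅ {H} {G} φ u v p c up vc = record
    { to = t ; from = f ; from-to = ft ; to-from = tf ; arcs = ar }
    where
    inj : ∀ a b → to φ a ≡ to φ b → a ≡ b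
    inj a b e = trans (sym (from-to φ a)) (trans (cong (from φ) e) (from-to φ b))
    eq-u : ∀ x → eqb x u ≡ eqb (to φ x) p
    eq-u x = trans (eqb-injective (to φ) inj x u) (cong (eqb (to φ x)) up)
    eq-v : ∀ x → eqb x v ≡ eqb (to φ x) c
    eq-v x = trans (eqb-injective (to φ) inj x v) (cong (eqb (to φ x)) vc)
    t : Fin (suc (V H)) → Fin (suc (V G))
    t zero = zero
    t (suc x) = suc (to φ x)
    f : Fin (suc (V G)) → Fin (suc (V H))
    f zero = zero
    f (suc x) = suc (from φ x)
    ft : ∀ x → f (t x) ≡ x
    ft zero = refl
    ft (suc x) = cong suc (from-to φ x)
    tf : ∀ x → t (f x) ≡ x
    tf zero = refl
    tf (suc x) = cong suc (to-from φ x)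
    ar : ∀ x y → E (subdivide H u v) x y ≡ E (subdivide G p c) (t x) (t y)
    ar zero zero = refl
    ar zero (suc y) = eq-v y
    ar (suc x) zero = eq-u x
    ar (suc x) (suc y) = cong₂ (λ a b → a ∧ not b) (arcs φ x y) (cong₂ _∧_ (eq-u x) (eq-v y))


module Subdivision where

  open Counting
  open Isomorphism
  open _≅_

  TreeProfile : Digraph → Set
  TreeProfile G = Σ (Fin (V G)) λ r → indeg G r ≡ 0 × (∀ v → ¬ v ≡ r → indeg G v ≡ 1) ×
           (∀ v → outdeg G v ≡ 0 → indeg G v ≡ 1)

  TreeProfile-≅ : ∀ {G H} → G ≅ H → TreeProfile G → TreeProfile H
  TreeProfile-≅ {G} {H} φ (r , r0 , r1 , ro) =
    to φ r , trans (≅-indeg φ r) r0 ,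
    (λ v ne → trans (cong (indeg H) (sym (to-from φ v)))
       (trans (≅-indeg φ (from φ v)) (r1 _ λ e → ne (trans (sym (to-from φ v)) (cong (to φ) e))))) ,
    λ v o → trans (cong (indeg H) (sym (to-from φ v)))
       (trans (≅-indeg φ (from φ v)) (ro _ (trans (sym (≅-outdeg φ (from φ v)))
          (trans (cong (outdeg H) (to-from φ v)) o))))

  module _ (H : Digraph) (u v : Fin (V H)) (uv : Arc H u v) where
    S = subdivide H u v

    subdivide-indeg-new : indeg S zero ≡ 1
    subdivide-indeg-new = trans (count-cong (λ x → E S (suc x) zero) (λ y → eqb y u) (λ x → refl)) (count-eqb u)

    subdivide-outdeg-new : outdeg S zero ≡ 1
    subdivide-outdeg-new = count-eqb v

    subdivide-indeg : ∀ y → indeg S (suc y) ≡ indeg H y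
    subdivide-indeg y with y ≟ v
    ... | yes refl = sym (trans (count-remove (λ x → E H x y) u uv)
         (cong suc (count-cong _ _ λ x → cong (λ b → E H x y ∧ not b) (sym (∧-identityʳ _)))))
    ... | no ne = count-cong _ _ λ x → trans (cong (λ b → E H x y ∧ not b) (∧-zeroʳ _)) (∧-identityʳ _)

    subdivide-outdeg : ∀ y → outdeg S (suc y) ≡ outdeg H y
    subdivide-outdeg y with y ≟ u
    ... | yes refl = sym (count-remove (λ x → E H y x) v uv)
    ... | no ne = count-cong (λ x → E H y x ∧ not (false ∧ eqb x v)) (λ x → E H y x) λ x → ∧-identityʳ _

    TreeProfile-subdivide : TreeProfile H → TreeProfile S
    TreeProfile-subdivide (r , r0 , r1 , ro) = suc r , trans (subdivide-indeg r) r0 , r1' , ro'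
      where
      r1' : ∀ w → ¬ w ≡ suc r → indeg S w ≡ 1
      r1' zero _ = subdivide-indeg-new
      r1' (suc y) ne = trans (subdivide-indeg y) (r1 y λ e → ne (cong suc e))
      ro' : ∀ w → outdeg S w ≡ 0 → indeg S w ≡ 1
      ro' zero o with () ← trans (sym subdivide-outdeg-new) o
      ro' (suc y) o = trans (subdivide-indeg y) (ro y (trans (sym (subdivide-outdeg y)) o))

  TreeProfile-steps : ∀ {G H} → SubdivSteps G H → TreeProfile G → TreeProfile H
  TreeProfile-steps base p = p
  TreeProfile-steps (step s u v a) p = TreeProfile-subdivide _ u v a (TreeProfile-steps s p)

  tree⇒TreeProfile : ∀ T → IsRootedBinaryPhyloTree T → TreeProfile T
  tree⇒TreeProfile T ((ac , (ρ , ρ0 , ρo , ρu , cls) , _) , no2) = ρ , ρ0 , r1 , ro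
    where
    r1 : ∀ v → ¬ v ≡ ρ → indeg T v ≡ 1
    r1 v ne with cls v ne
    ... | inj₁ (i , _) = i
    ... | inj₂ (inj₁ (i , _)) = i
    ... | inj₂ (inj₂ (i , _)) = ⊥-elim (no2 v i)
    root-not-sink : outdeg T ρ ≡ 1 ⊎ outdeg T ρ ≡ 2 → ¬ outdeg T ρ ≡ 0
    root-not-sink (inj₁ x) o with () ← trans (sym x) o
    root-not-sink (inj₂ x) o with () ← trans (sym x) o
    ro : ∀ v → outdeg T v ≡ 0 → indeg T v ≡ 1
    ro v o with v ≟ ρ
    ... | yes refl = ⊥-elim (root-not-sink ρo o)
    ... | no ne = r1 v ne

  subdivision⇒TreeProfile : ∀ G T → IsRootedBinaryPhyloTree T → IsSubdivisionOf G T → TreeProfile G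
  subdivision⇒TreeProfile G T t (H' , s , φ) = TreeProfile-≅ φ (TreeProfile-steps s (tree⇒TreeProfile T t))


module Suppression where

  open Counting
  open Isomorphism
  open _≅_

  Reach-trans : ∀ {G a b c} → Reach G a b → Reach G b c → Reach G a c
  Reach-trans (one x) q = more x q
  Reach-trans (more x p) q = more x (Reach-trans p q)

  record PreTree (G : Digraph) : Set where
    field
      acyc : Acyclic G
      r : Fin (V G)
      r-in : indeg G r ≡ 0
      in1 : ∀ v → ¬ v ≡ r → indeg G v ≡ 1
      out2 : ∀ v → outdeg G v ≤ 2
      r-out : 1 ≤ outdeg G r
      leaf : Σ (Fin (V G)) (IsLeaf G)
  open PreTree

  digraph : (n : ℕ) → (Fin n → Fin n → Bool) → Digraph
  digraph n e = record { V = n ; E = e }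

  SubdividedTree : Digraph → Set
  SubdividedTree G = Σ Digraph λ T → IsRootedBinaryPhyloTree T × IsSubdivisionOf G T

  Suppressible : ∀ {G} → PreTree G → Fin (V G) → Set
  Suppressible {G} g x = ¬ x ≡ r g × outdeg G x ≡ 1

  noSuppressible⇒tree : ∀ G → (g : PreTree G) → ¬ (Σ (Fin (V G)) (Suppressible g)) → SubdividedTree G
  noSuppressible⇒tree G g nx = G , ((acyc g , (r g , r-in g , rout , uniq , cls) , leaf g) , no2) , (G , base , ≅-refl G)
    where
    rout : outdeg G (r g) ≡ 1 ⊎ outdeg G (r g) ≡ 2
    rout with outdeg G (r g) | r-out g | out2 g (r g)
    ... | 1 | _ | _ = inj₁ refl
    ... | 2 | _ | _ = inj₂ refl
    ... | suc (suc (suc _)) | _ | s≤s (s≤s ())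
    uniq : ∀ v → indeg G v ≡ 0 → v ≡ r g
    uniq v i0 with v ≟ r g
    ... | yes e = e
    ... | no ne with () ← trans (sym (in1 g v ne)) i0
    cls : ∀ v → ¬ v ≡ r g → IsLeaf G v ⊎ (indeg G v ≡ 1 × outdeg G v ≡ 2) ⊎ (indeg G v ≡ 2 × outdeg G v ≡ 1)
    cls v ne with outdeg G v in eo | out2 g v
    ... | 0 | _ = inj₁ (in1 g v ne , refl)
    ... | 1 | _ = ⊥-elim (nx (v , ne , eo))
    ... | 2 | _ = inj₂ (inj₁ (in1 g v ne , refl))
    ... | suc (suc (suc _)) | s≤s (s≤s ())
    no2 : ∀ v → ¬ indeg G v ≡ 2
    no2 v i2 with v ≟ r g
    ... | yes refl with () ← trans (sym (r-in g)) i2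
    ... | no ne with () ← trans (sym (in1 g v ne)) i2

  -- Suppressing x (with parent p and child c) deletes x and adds the arc (p , c); the
  -- vertices of the smaller digraph are renumbered through punchIn x.
  module Suppress (n : ℕ) (e : Fin (suc n) → Fin (suc n) → Bool) (g : PreTree (digraph (suc n) e))
    (x : Fin (suc n)) (sx : Suppressible g x) where
    G = digraph (suc n) e
    xr = proj₁ sx
    xo = proj₂ sx
    pI = punchIn x
    ix : indeg G x ≡ 1
    ix = in1 g x xr
    p : Fin (suc n)
    p = proj₁ (count-witness (λ y → e y x) (≤-reflexive (sym ix)))
    ep : e p x ≡ true
    ep = proj₂ (count-witness (λ y → e y x) (≤-reflexive (sym ix)))
    c : Fin (suc n)
    c = proj₁ (count-witness (λ y → e x y) (≤-reflexive (sym xo)))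
    ec : e x c ≡ true
    ec = proj₂ (count-witness (λ y → e x y) (≤-reflexive (sym xo)))
    parent-unique : ∀ y → e y x ≡ true → y ≡ p
    parent-unique y ey = count≡1-unique (λ y → e y x) ix y p ey ep
    child-unique : ∀ y → e x y ≡ true → y ≡ c
    child-unique y ey = count≡1-unique _ xo y c ey ec
    noLoop : ∀ y → e y y ≡ true → ⊥
    noLoop y ey = acyc g y (one ey)
    p≢x : ¬ x ≡ p
    p≢x q = noLoop x (trans (cong (λ t → e t x) q) ep)
    c≢x : ¬ x ≡ c
    c≢x q = noLoop x (trans (cong (e x) q) ec)
    c≢r : ¬ c ≡ r g
    c≢r q with () ← ≤-trans (count-≥1 (λ y → e y c) x ec) (≤-reflexive (trans (cong (indeg G) q) (r-in g)))
    no-shortcut : e p c ≡ false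
    no-shortcut with e p c in q
    ... | false = refl
    ... | true = ⊥-elim (p≢x (sym (count≡1-unique (λ y → e y c) (in1 g c c≢r) p x q ec)))
    p' : Fin n
    p' = punchOut p≢x
    c' : Fin n
    c' = punchOut c≢x
    pp' : pI p' ≡ p
    pp' = punchIn-punchOut p≢x
    cc' : pI c' ≡ c
    cc' = punchIn-punchOut c≢x
    pinj : ∀ a b → pI a ≡ pI b → a ≡ b
    pinj = punchIn-injective x
    eqp : ∀ a → eqb (pI a) p ≡ eqb a p'
    eqp a = trans (cong (eqb (pI a)) (sym pp')) (sym (eqb-injective pI pinj a p'))
    eqc : ∀ a → eqb (pI a) c ≡ eqb a c'
    eqc a = trans (cong (eqb (pI a)) (sym cc')) (sym (eqb-injective pI pinj a c'))
    e' : Fin n → Fin n → Bool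
    e' a b = e (pI a) (pI b) ∨ (eqb (pI a) p ∧ eqb (pI b) c)
    G' = digraph n e'

    indeg-suppressed : ∀ b → indeg G' b ≡ indeg G (pI b)
    indeg-suppressed b with pI b ≟ c
    ... | yes q = trans (count-cong _ _ (λ a → cong (e (pI a) (pI b) ∨_) (trans (∧-identityʳ _) (eqp a))))
         (trans (count-add (λ a → e (pI a) (pI b)) p' (trans (cong₂ e pp' q) no-shortcut))
          (sym (trans (count-punchIn (λ y → e y (pI b)) x) (cong (λ t → b2n t + count (λ a → e (pI a) (pI b))) (trans (cong (e x) q) ec)))))
    ... | no ne = trans (count-cong _ _ (λ a → trans (cong (e (pI a) (pI b) ∨_) (∧-zeroʳ _)) (∨-identityʳ _)))
         (sym (trans (count-punchIn (λ y → e y (pI b)) x) (cong (λ t → b2n t + count (λ a → e (pI a) (pI b))) exb)))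
      where
      exb : e x (pI b) ≡ false
      exb with e x (pI b) in q
      ... | false = refl
      ... | true = ⊥-elim (ne (child-unique _ q))

    outdeg-suppressed : ∀ a → outdeg G' a ≡ outdeg G (pI a)
    outdeg-suppressed a with pI a ≟ p
    ... | yes q = trans (count-cong _ _ (λ b → cong (e (pI a) (pI b) ∨_) (eqc b)))
         (trans (count-add (λ b → e (pI a) (pI b)) c' (trans (cong₂ e q cc') no-shortcut))
          (sym (trans (count-punchIn (λ y → e (pI a) y) x) (cong (λ t → b2n t + count (λ b → e (pI a) (pI b))) (trans (cong (λ t → e t x) q) ep)))))
    ... | no ne = trans (count-cong (λ b → e (pI a) (pI b) ∨ false) (λ b → e (pI a) (pI b)) (λ b → ∨-identityʳ _))
         (sym (trans (count-punchIn (λ y → e (pI a) y) x) (cong (λ t → b2n t + count (λ b → e (pI a) (pI b))) eax)))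
      where
      eax : e (pI a) x ≡ false
      eax with e (pI a) x in q
      ... | false = refl
      ... | true = ⊥-elim (ne (parent-unique _ q))

    arc-suppressed⇒Reach : ∀ a b → e' a b ≡ true → Reach G (pI a) (pI b)
    arc-suppressed⇒Reach a b h with e (pI a) (pI b) in q
    ... | true = one q
    ... | false with pI a ≟ p | pI b ≟ c
    ... | yes qa | yes qb = more (trans (cong (λ t → e t x) qa) ep) (one (trans (cong (e x) qb) ec))
    ... | yes _ | no _ with () ← h
    ... | no _ | yes _ with () ← h
    ... | no _ | no _ with () ← h

    Reach-suppressed : ∀ {a b} → Reach G' a b → Reach G (pI a) (pI b)
    Reach-suppressed (one h) = arc-suppressed⇒Reach _ _ h
    Reach-suppressed (more h q) = Reach-trans (arc-suppressed⇒Reach _ _ h) (Reach-suppressed q)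

    r' : Fin n
    r' = punchOut xr
    rr' : pI r' ≡ r g
    rr' = punchIn-punchOut xr

    leaf-suppressed : Σ (Fin n) (IsLeaf G')
    leaf-suppressed with leaf g
    ... | ℓ , il , ol = punchOut ℓx , trans (indeg-suppressed _) (trans (cong (indeg G) (punchIn-punchOut ℓx)) il) ,
                                     trans (outdeg-suppressed _) (trans (cong (outdeg G) (punchIn-punchOut ℓx)) ol)
      where
      ℓx : ¬ x ≡ ℓ
      ℓx q with () ← trans (sym xo) (trans (cong (outdeg G) q) ol)

    PreTree-suppressed : PreTree G'
    PreTree-suppressed = record
      { acyc = λ v cyc → acyc g (pI v) (Reach-suppressed cyc)
      ; r = r'
      ; r-in = trans (indeg-suppressed r') (trans (cong (indeg G) rr') (r-in g))
      ; in1 = λ v ne → trans (indeg-suppressed v) (in1 g (pI v) λ q → ne (pinj v r' (trans q (sym rr'))))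
      ; out2 = λ v → subst (_≤ 2) (sym (outdeg-suppressed v)) (out2 g (pI v))
      ; r-out = subst (1 ≤_) (sym (outdeg-suppressed r')) (subst (λ t → 1 ≤ outdeg G t) (sym rr') (r-out g))
      ; leaf = leaf-suppressed }

    arc-p'c' : Arc G' p' c'
    arc-p'c' = trans (cong₂ (λ s t → e s t ∨ (eqb s p ∧ eqb t c)) pp' cc')
           (trans (cong (λ z → e p c ∨ (z ∧ eqb c c)) (eqb-refl p)) (trans (cong (λ z → e p c ∨ z) (eqb-refl c)) (∨-zeroʳ _)))

    subdivide-suppressed≅ : subdivide G' p' c' ≅ G
    subdivide-suppressed≅ = record { to = t ; from = f ; from-to = ft ; to-from = tf ; arcs = ar }
      where
      t : Fin (suc n) → Fin (suc n)
      t zero = x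
      t (suc a) = pI a
      f : Fin (suc n) → Fin (suc n)
      f y with x ≟ y
      ... | yes _ = zero
      ... | no ne = suc (punchOut ne)
      ft : ∀ y → f (t y) ≡ y
      ft zero with x ≟ x
      ... | yes _ = refl
      ... | no ne = ⊥-elim (ne refl)
      ft (suc a) with x ≟ pI a
      ... | yes q = ⊥-elim (punchInᵢ≢i x a (sym q))
      ... | no ne = cong suc (pinj _ _ (punchIn-punchOut ne))
      tf : ∀ y → t (f y) ≡ y
      tf y with x ≟ y
      ... | yes q = q
      ... | no ne = punchIn-punchOut ne
      ar : ∀ a b → E (subdivide G' p' c') a b ≡ e (t a) (t b)
      ar zero zero with e x x in q
      ... | false = refl
      ... | true = ⊥-elim (noLoop x q)
      ar zero (suc b) with e x (pI b) in q
      ... | true = trans (sym (eqc b)) (trans (cong (λ t → eqb t c) (child-unique _ q)) (eqb-refl c))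
      ... | false with b ≟ c'
      ... | yes h with () ← trans (sym q) (trans (cong (λ t → e x (pI t)) h) (trans (cong (e x) cc') ec))
      ... | no _ = refl
      ar (suc a) zero with e (pI a) x in q
      ... | true = trans (sym (eqp a)) (trans (cong (λ t → eqb t p) (parent-unique _ q)) (eqb-refl p))
      ... | false with a ≟ p'
      ... | yes h with () ← trans (sym q) (trans (cong (λ t → e (pI t) x) h) (trans (cong (λ t → e t x) pp') ep))
      ... | no _ = refl
      ar (suc a) (suc b) = trans (cong (λ z → e' a b ∧ not z) (sym (cong₂ _∧_ (eqp a) (eqc b)))) new-arc-removed
        where
        new-arc-removed : e' a b ∧ not (eqb (pI a) p ∧ eqb (pI b) c) ≡ e (pI a) (pI b)
        new-arc-removed with pI a ≟ p | pI b ≟ c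
        ... | yes qa | yes qb = trans (∧-zeroʳ _) (sym (trans (cong₂ e qa qb) no-shortcut))
        ... | yes _ | no _ = trans (∧-identityʳ _) (∨-identityʳ _)
        ... | no _ | yes _ = trans (∧-identityʳ _) (∨-identityʳ _)
        ... | no _ | no _ = trans (∧-identityʳ _) (∨-identityʳ _)

  -- Induction on the number of vertices: suppress a vertex, build the tree for the smaller
  -- digraph, and undo the suppression by a subdivision step.
  suppress : ∀ n (e : Fin n → Fin n → Bool) → PreTree (digraph n e) → SubdividedTree (digraph n e)
  suppress zero e g with r g
  ... | ()
  suppress (suc n) e g with any? (λ x → ¬? (x ≟ r g) ×-dec (outdeg (digraph (suc n) e) x ℕ.≟ 1))
  ... | no nx = noSuppressible⇒tree (digraph (suc n) e) g nx
  ... | yes (x , sx) with suppress n (Suppress.e' n e g x sx) (Suppress.PreTree-suppressed n e g x sx)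
  ... | T , tT , H' , ss , φ =
    T , tT , subdivide H' u v , step ss u v uv , ≅-trans (subdivide-≅ φ u v p' c' (to-from φ p') (to-from φ c')) subdivide-suppressed≅
    where
    open Suppress n e g x sx
    u = from φ p'
    v = from φ c'
    uv : Arc H' u v
    uv = trans (arcs φ u v) (trans (cong₂ e' (to-from φ p') (to-from φ c')) arc-p'c')


module LocalCharacterisation where

  open Counting
  open Subdivision
  open Suppression

  Local : (N : Digraph) → ArcSet N → Set
  Local N A = (∀ v → 1 ≤ indeg N v → indeg (spanning N A) v ≡ 1) ×
              (∀ v → 1 ≤ outdeg N v → 1 ≤ outdeg (spanning N A) v)

  module Network (N : Digraph) (nw : IsRootedBinaryPhyloNetwork N) where
    ρ : Fin (V N)
    ρ = proj₁ (proj₁ (proj₂ nw))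
    ρ0 : indeg N ρ ≡ 0
    ρ0 = proj₁ (proj₂ (proj₁ (proj₂ nw)))
    ρo : outdeg N ρ ≡ 1 ⊎ outdeg N ρ ≡ 2
    ρo = proj₁ (proj₂ (proj₂ (proj₁ (proj₂ nw))))
    ρu : ∀ v → indeg N v ≡ 0 → v ≡ ρ
    ρu = proj₁ (proj₂ (proj₂ (proj₂ (proj₁ (proj₂ nw)))))
    cls : ∀ v → ¬ v ≡ ρ → IsLeaf N v ⊎ (indeg N v ≡ 1 × outdeg N v ≡ 2) ⊎ (indeg N v ≡ 2 × outdeg N v ≡ 1)
    cls = proj₂ (proj₂ (proj₂ (proj₂ (proj₁ (proj₂ nw)))))

    ρout : 1 ≤ outdeg N ρ
    ρout with ρo
    ... | inj₁ q = ≤-reflexive (sym q)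
    ... | inj₂ q = subst (1 ≤_) (sym q) (s≤s z≤n)

    in≤2 : ∀ v → indeg N v ≤ 2
    in≤2 v with v ≟ ρ
    ... | yes refl = subst (_≤ 2) (sym ρ0) z≤n
    ... | no ne with cls v ne
    ... | inj₁ (i , _) = subst (_≤ 2) (sym i) (s≤s z≤n)
    ... | inj₂ (inj₁ (i , _)) = subst (_≤ 2) (sym i) (s≤s z≤n)
    ... | inj₂ (inj₂ (i , _)) = ≤-reflexive i

    out≤2 : ∀ v → outdeg N v ≤ 2
    out≤2 v with v ≟ ρ
    ... | yes refl with ρo
    ... | inj₁ q = subst (_≤ 2) (sym q) (s≤s z≤n)
    ... | inj₂ q = ≤-reflexive q
    out≤2 v | no ne with cls v ne
    ... | inj₁ (_ , o) = subst (_≤ 2) (sym o) z≤n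
    ... | inj₂ (inj₁ (_ , o)) = ≤-reflexive o
    ... | inj₂ (inj₂ (_ , o)) = subst (_≤ 2) (sym o) (s≤s z≤n)

    in-pos : ∀ v → ¬ v ≡ ρ → 1 ≤ indeg N v
    in-pos v ne with indeg N v in q
    ... | zero = ⊥-elim (ne (ρu v q))
    ... | suc _ = s≤s z≤n

    module _ (A : ArcSet N) (sub : SubArcs N A (E N)) where
      SA = spanning N A
      indeg-spanning≤ : ∀ v → indeg SA v ≤ indeg N v
      indeg-spanning≤ v = count-mono _ _ (λ u → sub u v)
      outdeg-spanning≤ : ∀ v → outdeg SA v ≤ outdeg N v
      outdeg-spanning≤ v = count-mono _ _ (λ u → sub v u)
      ρA0 : indeg SA ρ ≡ 0
      ρA0 = n≤0⇒n≡0 (subst (indeg SA ρ ≤_) ρ0 (indeg-spanning≤ ρ))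

      subdivisionTree⇒Local : IsSubdivisionTree N A → Local N A
      subdivisionTree⇒Local (_ , (T , tT , sd) , lf) = inP , outP
        where
        ps = subdivision⇒TreeProfile SA T tT sd
        r = proj₁ ps
        r1 = proj₁ (proj₂ (proj₂ ps))
        ro = proj₂ (proj₂ (proj₂ ps))
        ρr : ρ ≡ r
        ρr with ρ ≟ r
        ... | yes q = q
        ... | no ne with () ← trans (sym (r1 ρ ne)) ρA0
        inP : ∀ v → 1 ≤ indeg N v → indeg SA v ≡ 1
        inP v pos = r1 v λ q → n≮0 (subst (1 ≤_) ρ0 (subst (λ t → 1 ≤ indeg N t) (trans q (sym ρr)) pos))
        outP : ∀ v → 1 ≤ outdeg N v → 1 ≤ outdeg SA v
        outP v pos with outdeg SA v in q
        ... | suc _ = s≤s z≤n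
        ... | zero = ⊥-elim (n≮0 (subst (1 ≤_) (proj₂ (Equivalence.to (lf v) (ro v q , q))) pos))

      Local⇒subdivisionTree : Local N A → IsSubdivisionTree N A
      Local⇒subdivisionTree (inP , outP) = sub , suppress (V N) A g , leaves
        where
        Reach-spanning : ∀ {a b} → Reach SA a b → Reach N a b
        Reach-spanning (one h) = one (sub _ _ h)
        Reach-spanning (more h q) = more (sub _ _ h) (Reach-spanning q)
        leaf⇒leaf-spanning : ∀ v → IsLeaf N v → IsLeaf SA v
        leaf⇒leaf-spanning v (i , o) = inP v (≤-reflexive (sym i)) , n≤0⇒n≡0 (subst (outdeg SA v ≤_) o (outdeg-spanning≤ v))
        g : PreTree SA
        g = record
          { acyc = λ v c → proj₁ nw v (Reach-spanning c)
          ; r = ρ ; r-in = ρA0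
          ; in1 = λ v ne → inP v (in-pos v ne)
          ; out2 = λ v → ≤-trans (outdeg-spanning≤ v) (out≤2 v)
          ; r-out = outP ρ ρout
          ; leaf = proj₁ (proj₂ (proj₂ nw)) , leaf⇒leaf-spanning _ (proj₂ (proj₂ (proj₂ nw))) }
        leaf-spanning⇒leaf : ∀ v → IsLeaf SA v → IsLeaf N v
        leaf-spanning⇒leaf v (i , o) with v ≟ ρ
        ... | yes refl with () ← trans (sym i) ρA0
        ... | no ne with cls v ne
        ... | inj₁ l = l
        ... | inj₂ (inj₁ (_ , o2)) = ⊥-elim (n≮0 (subst (1 ≤_) o (outP v (subst (1 ≤_) (sym o2) (s≤s z≤n)))))
        ... | inj₂ (inj₂ (_ , o1)) = ⊥-elim (n≮0 (subst (1 ≤_) o (outP v (subst (1 ≤_) (sym o1) (s≤s z≤n)))))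
        leaves : ∀ v → IsLeaf SA v ⇔ IsLeaf N v
        leaves v = mk⇔ (leaf-spanning⇒leaf v) (leaf⇒leaf-spanning v)


module Segments where


  applyFrom : ∀ {A : Set} → (ℕ → A) → ℕ → ℕ → List A
  applyFrom f s zero = []
  applyFrom f s (suc n) = f s ∷ applyFrom f (suc s) n

  applyFrom-length : ∀ {A : Set} (f : ℕ → A) s n → length (applyFrom f s n) ≡ n
  applyFrom-length f s zero = refl
  applyFrom-length f s (suc n) = cong suc (applyFrom-length f (suc s) n)

  applyFrom-++ : ∀ {A : Set} (f : ℕ → A) s a b → applyFrom f s (a + b) ≡ applyFrom f s a ++ applyFrom f (a + s) b
  applyFrom-++ f s zero b = refl
  applyFrom-++ f s (suc a) b = cong (f s ∷_) (trans (applyFrom-++ f (suc s) a b) (cong (λ t → applyFrom f (suc s) a ++ applyFrom f t b) (+-suc a s)))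

  applyFrom-cong : ∀ {A : Set} (f g : ℕ → A) s n → (∀ i → i < n → f (i + s) ≡ g (i + s)) → applyFrom f s n ≡ applyFrom g s n
  applyFrom-cong f g s zero h = refl
  applyFrom-cong f g s (suc n) h = cong₂ _∷_ (h 0 (s≤s z≤n))
    (applyFrom-cong f g (suc s) n λ i i<n → trans (cong f (+-suc i s)) (trans (h (suc i) (s≤s i<n)) (cong g (sym (+-suc i s)))))

  applyFrom-injective : ∀ {A : Set} (f g : ℕ → A) s n → applyFrom f s n ≡ applyFrom g s n → ∀ i → i < n → f (i + s) ≡ g (i + s)
  applyFrom-injective f g s (suc n) e zero _ = proj₁ (∷-injective e)
  applyFrom-injective f g s (suc n) e (suc i) (s≤s i<n) =
    trans (cong f (sym (+-suc i s))) (trans (applyFrom-injective f g (suc s) n (proj₂ (∷-injective e)) i i<n) (cong g (+-suc i s)))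

  tabulate-applyFrom : ∀ {A : Set} (f : ℕ → A) n s (g : Fin n → A) → (∀ j → g j ≡ f (toℕ j + s)) → tabulate g ≡ applyFrom f s n
  tabulate-applyFrom f zero s g h = refl
  tabulate-applyFrom f (suc n) s g h = cong₂ _∷_ (h zero) (tabulate-applyFrom f n (suc s) (g ∘ suc) λ j → trans (h (suc j)) (cong f (sym (+-suc (toℕ j) s))))

  applyFrom-All : ∀ {A : Set} (P : A → Set) (f : ℕ → A) s n → (∀ i → i < n → P (f (i + s))) → All P (applyFrom f s n)
  applyFrom-All P f s zero h = []
  applyFrom-All P f s (suc n) h = h 0 (s≤s z≤n) ∷ applyFrom-All P f (suc s) n λ i i<n → subst P (cong f (sym (+-suc i s))) (h (suc i) (s≤s i<n))

  applyFrom-∈⁻ : ∀ {A : Set} (f : ℕ → A) s n {a} → a ∈ applyFrom f s n → Σ ℕ λ i → i < n × f (i + s) ≡ a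
  applyFrom-∈⁻ f s (suc n) (here refl) = 0 , s≤s z≤n , refl
  applyFrom-∈⁻ f s (suc n) (there p) with applyFrom-∈⁻ f (suc s) n p
  ... | i , i<n , e = suc i , s≤s i<n , trans (cong f (sym (+-suc i s))) e

  applyFrom-∈⁺ : ∀ {A : Set} (f : ℕ → A) s n i → i < n → f (i + s) ∈ applyFrom f s n
  applyFrom-∈⁺ f s (suc n) zero _ = here refl
  applyFrom-∈⁺ f s (suc n) (suc i) (s≤s i<n) = there (subst (_∈ applyFrom f (suc s) n) (cong f (+-suc i s)) (applyFrom-∈⁺ f (suc s) n i i<n))

  applyFrom-Unique : ∀ {A : Set} (f : ℕ → A) s n → (∀ i j → i < n → j < n → f (i + s) ≡ f (j + s) → i ≡ j) →
    AllPairs (λ x y → ¬ x ≡ y) (applyFrom f s n)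
  applyFrom-Unique f s zero h = []
  applyFrom-Unique f s (suc n) h = allne ∷ applyFrom-Unique f (suc s) n h'
    where
    h' : ∀ i j → i < n → j < n → f (i + suc s) ≡ f (j + suc s) → i ≡ j
    h' i j i<n j<n e = suc-injective (h (suc i) (suc j) (s≤s i<n) (s≤s j<n)
      (trans (cong f (sym (+-suc i s))) (trans e (cong f (+-suc j s)))))
    allne : All (λ y → ¬ f s ≡ y) (applyFrom f (suc s) n)
    allne = applyFrom-All _ f (suc s) n λ i i<n e → 0≢1+n (h 0 (suc i) (s≤s z≤n) (s≤s i<n) (trans e (cong f (+-suc i s))))

  applyFrom-Linked : ∀ {A : Set} (R : A → A → Set) (f : ℕ → A) s n →
    (∀ i → suc i < n → R (f (i + s)) (f (suc i + s))) → Linked R (applyFrom f s n)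
  applyFrom-Linked R f s zero h = []
  applyFrom-Linked R f s (suc zero) h = [-]
  applyFrom-Linked R f s (suc (suc n)) h = h 0 (s≤s (s≤s z≤n)) ∷
    subst (λ l → Linked R (f (suc s) ∷ l)) refl
     (applyFrom-Linked R f (suc s) (suc n) λ i i< → subst₂ R (cong f (sym (+-suc i s))) (cong f (cong suc (sym (+-suc i s)))) (h (suc i) (s≤s i<)))

  tabulate-injective : ∀ {n} (f g : Fin n → Bool) → tabulate f ≡ tabulate g → ∀ j → f j ≡ g j
  tabulate-injective {suc n} f g e zero = proj₁ (∷-injective e)
  tabulate-injective {suc n} f g e (suc j) = tabulate-injective (f ∘ suc) (g ∘ suc) (proj₂ (∷-injective e)) j

  lookupᵇ : List Bool → ℕ → Bool
  lookupᵇ [] _ = false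
  lookupᵇ (b ∷ _) zero = b
  lookupᵇ (_ ∷ l) (suc n) = lookupᵇ l n

  tabulate-lookupᵇ : ∀ (l : List Bool) n → length l ≡ n → tabulate {n = n} (λ j → lookupᵇ l (toℕ j)) ≡ l
  tabulate-lookupᵇ [] zero _ = refl
  tabulate-lookupᵇ (b ∷ l) (suc n) e = cong (b ∷_) (tabulate-lookupᵇ l n (suc-injective e))

  Linked-cons : ∀ {A : Set} (R : A → A → Set) {x} (f : ℕ → A) s n → 1 ≤ n → R x (f s) → Linked R (applyFrom f s n) → Linked R (x ∷ applyFrom f s n)
  Linked-cons R f s (suc n) _ r l = r ∷ l


module AlternatingWalks where

  open Counting

  false≢true : ¬ false ≡ true
  false≢true ()

  even : ℕ → Bool
  even zero = true
  even (suc n) = not (even n)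

  alt-not : ∀ d k → alt (not d) k ≡ not (alt d k)
  alt-not d zero = refl
  alt-not d (suc k) = alt-not (not d) k

  alt-suc : ∀ d k → alt d (suc k) ≡ not (alt d k)
  alt-suc d k = alt-not d k

  alt≡even : ∀ d k → alt d k ≡ (if d then even k else not (even k))
  alt≡even true zero = refl
  alt≡even false zero = refl
  alt≡even true (suc k) = trans (alt-not true k) (cong not (alt≡even true k))
  alt≡even false (suc k) = trans (alt-not false k) (cong not (alt≡even false k))

  alt-add : ∀ d a b → alt d (a + b) ≡ alt (alt d a) b
  alt-add d zero b = refl
  alt-add d (suc a) b = alt-add (not d) a b

  alt-alt : ∀ d a → alt (alt d a) a ≡ d
  alt-alt d zero = refl
  alt-alt d (suc a) = trans (alt-not (alt (not d) a) a) (trans (cong not (alt-alt (not d) a)) (not-involutive d))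

  even-double : ∀ a → even (a + a) ≡ true
  even-double zero = refl
  even-double (suc a) = trans (cong (λ t → not (even t)) (+-suc a a)) (trans (not-involutive _) (even-double a))

  parity : ∀ m → Σ ℕ λ k → (m ≡ k + k × even m ≡ true) ⊎ (m ≡ suc (k + k) × even m ≡ false)
  parity zero = 0 , inj₁ (refl , refl)
  parity (suc m) with parity m
  ... | k , inj₁ (e , q) = k , inj₂ (cong suc e , cong not q)
  ... | k , inj₂ (e , q) = suc k , inj₁ (trans (cong suc e) (cong suc (sym (+-suc k k))) , cong not q)

  -- A flag s selects a side: pair true a b is the arc a → b, pair false a b the arc b → a;
  -- adj s, deg s and end s mean out-neighbour, out-degree and tail for s = true, and
  -- in-neighbour, in-degree and head for s = false.
  pair : ∀ {n} → Bool → Fin n → Fin n → Fin n × Fin n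
  pair true a b = a , b
  pair false a b = b , a

  end : ∀ {n} → Bool → Fin n × Fin n → Fin n
  end true e = proj₁ e
  end false e = proj₂ e

  otherEnd : ∀ {n} → Bool → Fin n × Fin n → Fin n
  otherEnd s e = end (not s) e

  end-pair : ∀ {n} s (a b : Fin n) → end s (pair s a b) ≡ a
  end-pair true a b = refl
  end-pair false a b = refl

  otherEnd-pair : ∀ {n} s (a b : Fin n) → otherEnd s (pair s a b) ≡ b
  otherEnd-pair true a b = refl
  otherEnd-pair false a b = refl

  pair-flip : ∀ {n} s (a b : Fin n) → pair (not s) b a ≡ pair s a b
  pair-flip true a b = refl
  pair-flip false a b = refl

  pair-injˡ : ∀ {n} s {a b a' b' : Fin n} → pair s a b ≡ pair s a' b' → a ≡ a'
  pair-injˡ s e = trans (sym (end-pair s _ _)) (trans (cong (end s) e) (end-pair s _ _))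

  pair-injʳ : ∀ {n} s {a b a' b' : Fin n} → pair s a b ≡ pair s a' b' → b ≡ b'
  pair-injʳ s e = trans (sym (otherEnd-pair s _ _)) (trans (cong (otherEnd s) e) (otherEnd-pair s _ _))

  on : ∀ {n} → (Fin n → Fin n → Bool) → Fin n × Fin n → Bool
  on F e = F (proj₁ e) (proj₂ e)

  adj : ∀ {n} → Bool → (Fin n → Fin n → Bool) → Fin n → Fin n → Bool
  adj true F a b = F a b
  adj false F a b = F b a

  adj-pair : ∀ {n} s (F : Fin n → Fin n → Bool) a b → on F (pair s a b) ≡ adj s F a b
  adj-pair true F a b = refl
  adj-pair false F a b = refl

  deg : ∀ {n} → Bool → (Fin n → Fin n → Bool) → Fin n → ℕ
  deg s F v = count (adj s F v)

  walkArcℕ : ∀ {n} → Bool → (ℕ → Fin n) → ℕ → Fin n × Fin n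
  walkArcℕ d w j = pair (alt d j) (w j) (w (suc j))

  walkArcℕ-suc : ∀ {n} d (w : ℕ → Fin n) j → walkArcℕ d w j ≡ pair (alt d (suc j)) (w (suc j)) (w j)
  walkArcℕ-suc d w j = trans (sym (pair-flip (alt d j) (w j) (w (suc j)))) (cong (λ t → pair t (w (suc j)) (w j)) (sym (alt-suc d j)))

  -- The walk w 0 , … , w m, indexed by ℕ (values beyond m are irrelevant); its j-th arc
  -- joins w j and w (suc j) and points forward iff alt d j.
  record AltWalk (N : Digraph) (B : ArcSet N) : Set where
    field
      m : ℕ
      d : Bool
      w : ℕ → Fin (V N)
      inj : ∀ j k → j < m → k < m → walkArcℕ d w j ≡ walkArcℕ d w k → j ≡ k
      cov : ∀ u v → B u v ≡ true → Σ ℕ λ j → j < m × walkArcℕ d w j ≡ (u , v)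
      mem : ∀ j → j < m → on B (walkArcℕ d w j) ≡ true

  clamp : ∀ m → ℕ → Fin (suc m)
  clamp zero k = zero
  clamp (suc m) zero = zero
  clamp (suc m) (suc k) = suc (clamp m k)

  clamp-toℕ : ∀ m (i : Fin (suc m)) → clamp m (toℕ i) ≡ i
  clamp-toℕ zero zero = refl
  clamp-toℕ (suc m) zero = refl
  clamp-toℕ (suc m) (suc i) = cong suc (clamp-toℕ m i)

  clamp-inj : ∀ m (j : Fin m) → clamp m (toℕ j) ≡ inject₁ j
  clamp-inj (suc m) zero = refl
  clamp-inj (suc m) (suc j) = cong suc (clamp-inj m j)

  clamp-suc : ∀ m (j : Fin m) → clamp m (suc (toℕ j)) ≡ suc j
  clamp-suc m j = clamp-toℕ m (suc j)

  walkArc-pair : ∀ {n m} d (v : Fin (suc m) → Fin n) j →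
    walkArc d v j ≡ pair (alt d (toℕ j)) (v (inject₁ j)) (v (suc j))
  walkArc-pair d v j with alt d (toℕ j)
  ... | true = refl
  ... | false = refl

  walkArc-clamp : ∀ {n m} d (v : Fin (suc m) → Fin n) j → walkArc d v j ≡ walkArcℕ d (v ∘ clamp m) (toℕ j)
  walkArc-clamp {m = m} d v j = trans (walkArc-pair d v j)
    (cong₂ (pair (alt d (toℕ j))) (cong v (sym (clamp-inj m j))) (cong v (sym (clamp-suc m j))))

  walkArc-toℕ : ∀ {n m} d (w : ℕ → Fin n) (j : Fin m) → walkArc d (λ (k : Fin (suc m)) → w (toℕ k)) j ≡ walkArcℕ d w (toℕ j)
  walkArc-toℕ {m = m} d w j = trans (walkArc-pair d (λ (k : Fin (suc m)) → w (toℕ k)) j) (cong (λ t → pair (alt d (toℕ j)) (w t) (w (suc (toℕ j)))) (toℕ-inject₁ j))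

  module _ {N : Digraph} {B : ArcSet N} where
    fromEnumeration : ∀ m d (v : Fin (suc m) → Fin (V N)) → Enumerates N B (walkArc d v) → AltWalk N B
    fromEnumeration m d v (inj , cv) = record { m = m ; d = d ; w = v ∘ clamp m ; inj = i ; cov = c ; mem = me }
      where
      W = v ∘ clamp m
      i : ∀ j k → j < m → k < m → walkArcℕ d W j ≡ walkArcℕ d W k → j ≡ k
      i j k j< k< e = trans (sym (toℕ-fromℕ< j<)) (trans (cong toℕ (inj _ _
         (trans (walkArc-clamp d v (fromℕ< j<)) (trans (cong (walkArcℕ d W) (toℕ-fromℕ< j<))
           (trans e (trans (cong (walkArcℕ d W) (sym (toℕ-fromℕ< k<))) (sym (walkArc-clamp d v (fromℕ< k<))))))))) (toℕ-fromℕ< k<))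
      c : ∀ u u' → B u u' ≡ true → Σ ℕ λ j → j < m × walkArcℕ d W j ≡ (u , u')
      c u u' b with Equivalence.to (cv u u') b
      ... | j , e = toℕ j , toℕ<n j , trans (sym (walkArc-clamp d v j)) e
      me : ∀ j → j < m → on B (walkArcℕ d W j) ≡ true
      me j j< with walkArcℕ d W j in q
      ... | (a , b) = Equivalence.from (cv a b) (fromℕ< j< , trans (walkArc-clamp d v (fromℕ< j<)) (trans (cong (walkArcℕ d W) (toℕ-fromℕ< j<)) q))

    toEnumeration : (W : AltWalk N B) → Enumerates N B (walkArc (AltWalk.d W) (λ (k : Fin (suc (AltWalk.m W))) → AltWalk.w W (toℕ k)))
    toEnumeration W = (λ j k e → toℕ-injective (AltWalk.inj W _ _ (toℕ<n j) (toℕ<n k)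
                 (trans (sym (walkArc-toℕ (AltWalk.d W) (AltWalk.w W) j)) (trans e (walkArc-toℕ (AltWalk.d W) (AltWalk.w W) k))))) ,
              λ u u' → mk⇔ (λ b → let (j , j< , e) = AltWalk.cov W u u' b in
                                fromℕ< j< , trans (walkArc-toℕ (AltWalk.d W) (AltWalk.w W) (fromℕ< j<)) (trans (cong (walkArcℕ (AltWalk.d W) (AltWalk.w W)) (toℕ-fromℕ< j<)) e))
                           (λ { (j , e) → subst (λ t → on B t ≡ true) (trans (sym (walkArc-toℕ (AltWalk.d W) (AltWalk.w W) j)) e)
                                             (AltWalk.mem W (toℕ j) (toℕ<n j)) })

  not-≢ : ∀ b → ¬ not b ≡ b
  not-≢ true ()
  not-≢ false ()

  alt≡⇒even : ∀ d k → alt d k ≡ d → even k ≡ true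
  alt≡⇒even true k e = trans (sym (alt≡even true k)) e
  alt≡⇒even false k e with even k | alt≡even false k
  ... | true | _ = refl
  ... | false | q = ⊥-elim (false≢true (trans (sym e) q))

  even-≢2⇒≥4 : ∀ k → even (suc k) ≡ true → ¬ k ≡ 1 → 4 ≤ suc k
  even-≢2⇒≥4 0 () _
  even-≢2⇒≥4 1 _ n = ⊥-elim (n refl)
  even-≢2⇒≥4 2 () _
  even-≢2⇒≥4 (suc (suc (suc k))) _ _ = s≤s (s≤s (s≤s (s≤s z≤n)))

  share-pair : ∀ {n} s (a b c : Fin n) → ShareEnd (pair s a b) (pair s a c)
  share-pair true a b c = inj₂ refl
  share-pair false a b c = inj₁ refl

  adj-mono : ∀ {n} s (F G : Fin n → Fin n → Bool) → (∀ a b → F a b ≡ true → G a b ≡ true) →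
    ∀ v u → adj s F v u ≡ true → adj s G v u ≡ true
  adj-mono true F G h v u = h v u
  adj-mono false F G h v u = h u v

  suc-∸1 : ∀ {m} → 1 ≤ m → suc (m ∸ 1) ≡ m
  suc-∸1 {suc m} _ = refl

  alt-even-period : ∀ d k → even k ≡ true → alt d k ≡ d
  alt-even-period true k e = trans (alt≡even true k) e
  alt-even-period false k e = trans (alt≡even false k) (cong not e)

  clamp-0 : ∀ m → clamp m 0 ≡ zero
  clamp-0 zero = refl
  clamp-0 (suc m) = refl

  clamp-m : ∀ m → clamp m m ≡ fromℕ m
  clamp-m zero = refl
  clamp-m (suc m) = cong suc (clamp-m m)

  ∧-true : ∀ {a b} → a ∧ b ≡ true → a ≡ true × b ≡ true
  ∧-true {true} {true} _ = refl , refl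


module TrailDegrees where

  open Counting
  open LocalCharacterisation
  open Segments
  open AlternatingWalks

  module InNetwork (N : Digraph) (nw : IsRootedBinaryPhyloNetwork N) where
    open Network N nw

    deg≤2 : ∀ s v → deg s (E N) v ≤ 2
    deg≤2 true v = out≤2 v
    deg≤2 false v = in≤2 v

    ¬3≤2 : ¬ 3 ≤ 2
    ¬3≤2 (s≤s (s≤s ()))

    module _ {B : ArcSet N} (mx : IsMaximalZigZagTrail N B) (W : AltWalk N B) where
      open AltWalk W
      trail⊆E : SubArcs N B (E N)
      trail⊆E = proj₁ (proj₁ mx)

      trail-arc∈E : ∀ j → j < m → on (E N) (walkArcℕ d w j) ≡ true
      trail-arc∈E j j< with walkArcℕ d w j | mem j j<
      ... | (a , b) | q = trail⊆E a b q

      adj-forward : ∀ (F : ArcSet N) j → adj (alt d j) F (w j) (w (suc j)) ≡ on F (walkArcℕ d w j)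
      adj-forward F j = sym (adj-pair (alt d j) F (w j) (w (suc j)))

      adj-backward : ∀ (F : ArcSet N) j → adj (alt d (suc j)) F (w (suc j)) (w j) ≡ on F (walkArcℕ d w j)
      adj-backward F j = trans (sym (adj-pair (alt d (suc j)) F (w (suc j)) (w j))) (cong (on F) (sym (walkArcℕ-suc d w j)))

      interior-neighbours-distinct : ∀ j → suc j < m → ¬ w j ≡ w (suc (suc j))
      interior-neighbours-distinct j j< e = <⇒≢ (n<1+n j) (inj j (suc j) (<-trans (n<1+n j) j<) j<
        (trans (walkArcℕ-suc d w j) (cong (pair (alt d (suc j)) (w (suc j))) e)))

      interior-neighbours : ∀ j → suc j < m → ∀ z → adj (alt d (suc j)) (E N) (w (suc j)) z ≡ true → z ≡ w j ⊎ z ≡ w (suc (suc j))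
      interior-neighbours j j< z h with z ≟ w j | z ≟ w (suc (suc j))
      ... | yes p | _ = inj₁ p
      ... | no _ | yes p = inj₂ p
      ... | no n1 | no n2 = ⊥-elim (¬3≤2 (≤-trans (count-≥3 _ (w j) (w (suc (suc j))) z (interior-neighbours-distinct j j<)
              (λ e → n1 (sym e)) (λ e → n2 (sym e))
              (trans (adj-backward (E N) j) (trail-arc∈E j (<-trans (n<1+n j) j<))) (trans (adj-forward (E N) (suc j)) (trail-arc∈E (suc j) j<)) h)
            (deg≤2 (alt d (suc j)) (w (suc j)))))

      interior-deg : ∀ (F : ArcSet N) → SubArcs N F (E N) → ∀ j → suc j < m →
        deg (alt d (suc j)) F (w (suc j)) ≡ b2n (on F (walkArcℕ d w j)) + b2n (on F (walkArcℕ d w (suc j)))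
      interior-deg F sub j j< = trans (count-pair _ _ (w j) (w (suc (suc j))) (interior-neighbours-distinct j j<)
          (adj-mono (alt d (suc j)) F (E N) sub (w (suc j))) (interior-neighbours j j<))
        (cong₂ _+_ (cong b2n (adj-backward F j)) (cong b2n (adj-forward F (suc j))))

      interior-deg≥2 : ∀ j → suc j < m → 2 ≤ deg (alt d (suc j)) (E N) (w (suc j))
      interior-deg≥2 j j< = count-≥2 _ (w j) (w (suc (suc j))) (interior-neighbours-distinct j j<)
              (trans (adj-backward (E N) j) (trail-arc∈E j (<-trans (n<1+n j) j<))) (trans (adj-forward (E N) (suc j)) (trail-arc∈E (suc j) j<))

      length≥1 : 1 ≤ m
      length≥1 with m in q | proj₂ (proj₁ mx)
      ... | suc _ | _ = s≤s z≤n
      ... | zero | ord , ne , _ , memb , _ = ⊥-elim (nonempty ord ne memb)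
        where
        nonempty : ∀ (o : List (Fin (V N) × Fin (V N))) → ¬ o ≡ [] → (∀ u v → B u v ≡ true ⇔ (u , v) ∈ o) → ⊥
        nonempty [] ne _ = ne refl
        nonempty ((a , b) ∷ o) _ memb with cov a b (Equivalence.from (memb a b) (here refl))
        ... | j , j< , _ = n≮0 (subst (j <_) q j<)

      -- By maximality: an arc at w 0 on the side of the first arc, but outside B, could be
      -- prepended to the trail.
      start-arcs-in-trail : ∀ u → adj d (E N) (w 0) u ≡ true → on B (pair d (w 0) u) ≡ true
      start-arcs-in-trail u hu with on B (pair d (w 0) u) in q
      ... | true = refl
      ... | false = trans (sym q) (proj₂ mx B' zz (λ a b h → trans (cong (λ t → t ∨ (eqb a (proj₁ e) ∧ eqb b (proj₂ e))) h) refl) (proj₁ e) (proj₂ e) Be')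
        where
        e = pair d (w 0) u
        B' : ArcSet N
        B' a b = B a b ∨ (eqb a (proj₁ e) ∧ eqb b (proj₂ e))
        Be' : B' (proj₁ e) (proj₂ e) ≡ true
        Be' = trans (cong₂ (λ x y → B (proj₁ e) (proj₂ e) ∨ (x ∧ y)) (eqb-refl (proj₁ e)) (eqb-refl (proj₂ e))) (∨-zeroʳ _)
        eE : on (E N) e ≡ true
        eE = trans (adj-pair d (E N) (w 0) u) hu
        sub' : SubArcs N B' (E N)
        sub' a b h with B a b in qb
        ... | true = trail⊆E a b qb
        ... | false with ∧-true h
        ... | h1 , h2 = subst₂ (λ x y → E N x y ≡ true) (sym (eqb-true h1)) (sym (eqb-true h2)) eE
        L = applyFrom (walkArcℕ d w) 0 m
        a0 : ∀ i → walkArcℕ d w (i + 0) ≡ walkArcℕ d w i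
        a0 i = cong (walkArcℕ d w) (+-identityʳ i)
        uq : AllPairs (λ x y → ¬ x ≡ y) (e ∷ L)
        uq = applyFrom-All (λ y → ¬ e ≡ y) (walkArcℕ d w) 0 m (λ i i< eq → false≢true (trans (sym q) (trans (cong (on B) eq) (trans (cong (on B) (a0 i)) (mem i i<)))))
             ∷ applyFrom-Unique (walkArcℕ d w) 0 m (λ i j i< j< eq → inj i j i< j< (trans (sym (a0 i)) (trans eq (a0 j))))
        memb : ∀ a b → B' a b ≡ true ⇔ (a , b) ∈ (e ∷ L)
        memb a b = mk⇔ to' from'
          where
          to' : B' a b ≡ true → (a , b) ∈ (e ∷ L)
          to' h with B a b in qb
          ... | true with cov a b qb
          ... | j , j< , ej = there (subst (_∈ L) (trans (a0 j) ej) (applyFrom-∈⁺ (walkArcℕ d w) 0 m j j<))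
          to' h | false with ∧-true h
          ... | h1 , h2 = here (cong₂ _,_ (eqb-true h1) (eqb-true h2))
          from' : (a , b) ∈ (e ∷ L) → B' a b ≡ true
          from' (here p) = subst₂ (λ x y → B' x y ≡ true) (sym (cong proj₁ p)) (sym (cong proj₂ p)) Be'
          from' (there p) with applyFrom-∈⁻ (walkArcℕ d w) 0 m p
          ... | i , i< , ei = trans (cong (λ t → t ∨ (eqb a (proj₁ e) ∧ eqb b (proj₂ e))) (subst (λ t → on B t ≡ true) (trans (sym (a0 i)) ei) (mem i i<))) refl
        lk : Linked ShareEnd (e ∷ L)
        lk = Linked-cons ShareEnd (walkArcℕ d w) 0 m length≥1 (share-pair d (w 0) u (w 1))
               (applyFrom-Linked ShareEnd (walkArcℕ d w) 0 m λ i i< →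
                 subst₂ ShareEnd (sym (trans (a0 i) (walkArcℕ-suc d w i))) (sym (a0 (suc i)))
                   (share-pair (alt d (suc i)) (w (suc i)) (w i) (w (suc (suc i)))))
        zz : IsZigZagTrail N B'
        zz = sub' , (e ∷ L) , (λ ()) , uq , memb , lk

      first-arc : adj d (E N) (w 0) (w 1) ≡ true
      first-arc = trans (adj-forward (E N) 0) (trail-arc∈E 0 length≥1)

      start-deg≥1 : 1 ≤ deg d (E N) (w 0)
      start-deg≥1 = count-≥1 _ (w 1) first-arc

      -- The second arc at w 0 lies on the trail; as interior vertices of a binary network have
      -- no further arcs, it can only be the last arc, which then ends at w 0.
      start-deg≥2⇒closed : 2 ≤ deg d (E N) (w 0) → even m ≡ true × 4 ≤ m × w m ≡ w 0
      start-deg≥2⇒closed dg with count-witness₂ (adj d (E N) (w 0)) (w 1) dg first-arc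
      ... | u , u≢ , hu with cov (proj₁ (pair d (w 0) u)) (proj₂ (pair d (w 0) u)) (start-arcs-in-trail u hu)
      ... | j , j< , ej with alt d j B≟ d
      ... | yes aq = ¬second-arc-forward j j< aq (trans (cong (λ t → pair t (w j) (w (suc j))) (sym aq)) ej)
        where
        ¬second-arc-forward : ∀ j → j < m → alt d j ≡ d → pair d (w j) (w (suc j)) ≡ pair d (w 0) u →
          even m ≡ true × 4 ≤ m × w m ≡ w 0
        ¬second-arc-forward zero _ _ e = ⊥-elim (u≢ (sym (pair-injʳ d e)))
        ¬second-arc-forward (suc k) k< aq e
          with interior-neighbours k k< (w 1) (subst₂ (λ s v → adj s (E N) v (w 1) ≡ true) (sym aq) (sym (pair-injˡ d e)) first-arc)
        ... | inj₁ p = ⊥-elim (not-≢ d (trans (sym (alt-suc d 0)) (subst (λ t → alt d (suc t) ≡ d) k≡0 aq)))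
          where
          k≡0 : k ≡ 0
          k≡0 = inj k 0 (<-trans (n<1+n k) k<) length≥1
             (trans (walkArcℕ-suc d w k) (trans (cong (λ t → pair t (w (suc k)) (w k)) aq) (cong₂ (pair d) (pair-injˡ d e) (sym p))))
        ... | inj₂ p = ⊥-elim (u≢ (trans (sym (pair-injʳ d e)) (sym p)))
      ... | no anq = second-arc-backward (suc j <? m)
        where
        asq : alt d (suc j) ≡ d
        asq = trans (alt-suc d j) (sym (¬-not (λ e → anq (sym e))))
        ej' : pair d (w (suc j)) (w j) ≡ pair d (w 0) u
        ej' = trans (cong (λ t → pair t (w (suc j)) (w j)) (sym asq)) (trans (sym (walkArcℕ-suc d w j)) ej)
        second-arc-backward : Dec (suc j < m) → even m ≡ true × 4 ≤ m × w m ≡ w 0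
        second-arc-backward (yes sj<)
          with interior-neighbours j sj< (w 1) (subst₂ (λ s v → adj s (E N) v (w 1) ≡ true) (sym asq) (sym (pair-injˡ d ej')) first-arc)
        ... | inj₁ p = ⊥-elim (u≢ (trans (sym (pair-injʳ d ej')) (sym p)))
        ... | inj₂ p = ⊥-elim (1+n≢0 (inj (suc j) 0 sj< length≥1
             (trans (cong (λ t → pair t (w (suc j)) (w (suc (suc j)))) asq) (cong₂ (pair d) (pair-injˡ d ej') (sym p)))))
        second-arc-backward (no ¬sj<) = subst (λ t → even t ≡ true × 4 ≤ t × w t ≡ w 0) (≤-antisym j< (≮⇒≥ ¬sj<))
          (even-sj , even-≢2⇒≥4 j even-sj (λ e → u≢ (sym (trans (cong w (sym e)) (pair-injʳ d ej')))) , pair-injˡ d ej')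
          where
          even-sj : even (suc j) ≡ true
          even-sj = alt≡⇒even d (suc j) asq

    Closed : ∀ {B} → AltWalk N B → Set
    Closed W = even (AltWalk.m W) ≡ true × 4 ≤ AltWalk.m W × AltWalk.w W (AltWalk.m W) ≡ AltWalk.w W 0

    sucm∸ : ∀ m j → j < m → suc (m ∸ suc j) ≡ m ∸ j
    sucm∸ (suc m) zero _ = refl
    sucm∸ (suc m) (suc j) (s≤s j<) = sucm∸ m j j<

    m∸suc< : ∀ m j → j < m → m ∸ suc j < m
    m∸suc< m j j< = ≤-trans (≤-reflexive (sucm∸ m j j<)) (m∸n≤m m j)

    alt-rev : ∀ d m j → j ≤ m → alt (alt d m) j ≡ alt d (m ∸ j)
    alt-rev d m j j≤ = trans (cong (λ t → alt (alt d t) j) (sym (m∸n+n≡m j≤)))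
      (trans (cong (λ t → alt t j) (alt-add d (m ∸ j) j)) (alt-alt (alt d (m ∸ j)) j))

    revArc : ∀ {B} (W : AltWalk N B) j → j < AltWalk.m W →
      walkArcℕ (alt (AltWalk.d W) (AltWalk.m W)) (λ k → AltWalk.w W (AltWalk.m W ∸ k)) j ≡ walkArcℕ (AltWalk.d W) (AltWalk.w W) (AltWalk.m W ∸ suc j)
    revArc W j j< = trans (cong (λ t → pair t (w (m ∸ j)) (w (m ∸ suc j))) (alt-rev d m j (<⇒≤ j<)))
         (trans (cong (λ t → pair (alt d t) (w t) (w (m ∸ suc j))) (sym (sucm∸ m j j<))) (sym (walkArcℕ-suc d w (m ∸ suc j))))
      where open AltWalk W

    rev : ∀ {B} → AltWalk N B → AltWalk N B
    rev {B} W = record { m = m ; d = alt d m ; w = λ k → w (m ∸ k) ; inj = i' ; cov = c' ; mem = me' }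
      where
      open AltWalk W
      w' : ℕ → Fin (V N)
      w' k = w (m ∸ k)
      ra : ∀ j → j < m → walkArcℕ (alt d m) w' j ≡ walkArcℕ d w (m ∸ suc j)
      ra = revArc W
      i' : ∀ j k → j < m → k < m → walkArcℕ (alt d m) w' j ≡ walkArcℕ (alt d m) w' k → j ≡ k
      i' j k j< k< e = suc-injective (∸-cancelˡ-≡ j< k< (inj _ _ (m∸suc< m j j<) (m∸suc< m k k<) (trans (sym (ra j j<)) (trans e (ra k k<)))))
      c' : ∀ a b → B a b ≡ true → Σ ℕ λ j → j < m × walkArcℕ (alt d m) w' j ≡ (a , b)
      c' a b h with cov a b h
      ... | i , i< , ei = m ∸ suc i , m∸suc< m i i< ,
           trans (ra (m ∸ suc i) (m∸suc< m i i<)) (trans (cong (walkArcℕ d w) eqi) ei)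
        where
        eqi : m ∸ suc (m ∸ suc i) ≡ i
        eqi = trans (cong (m ∸_) (sucm∸ m i i<)) (m∸[m∸n]≡n (<⇒≤ i<))
      me' : ∀ j → j < m → on B (walkArcℕ (alt d m) w' j) ≡ true
      me' j j< = trans (cong (on B) (ra j j<)) (mem _ (m∸suc< m j j<))

    closed⊎open : ∀ {B} (mx : IsMaximalZigZagTrail N B) (W : AltWalk N B) →
      Closed W ⊎ (deg (AltWalk.d W) (E N) (AltWalk.w W 0) ≡ 1 × deg (alt (AltWalk.d W) (AltWalk.m W)) (E N) (AltWalk.w W (AltWalk.m W)) ≡ 1)
    closed⊎open mx W with deg (AltWalk.d W) (E N) (AltWalk.w W 0) in q0
    ... | 0 = ⊥-elim (n≮0 (subst (1 ≤_) q0 (start-deg≥1 mx W)))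
    ... | suc (suc k) = inj₁ (start-deg≥2⇒closed mx W (subst (2 ≤_) (sym q0) (s≤s (s≤s z≤n))))
    ... | 1 with deg (alt (AltWalk.d W) (AltWalk.m W)) (E N) (AltWalk.w W (AltWalk.m W)) in qm
    ... | 0 = ⊥-elim (n≮0 (subst (1 ≤_) qm (start-deg≥1 mx (rev W))))
    ... | 1 = inj₂ (refl , refl)
    ... | suc (suc k) with start-deg≥2⇒closed mx (rev W) (subst (2 ≤_) (sym qm) (s≤s (s≤s z≤n)))
    ... | e , f , g = inj₁ (e , f , trans (sym g) (cong (AltWalk.w W) (n∸n≡0 (AltWalk.m W))))

    module StartEnd {B : ArcSet N} (mx : IsMaximalZigZagTrail N B) (W : AltWalk N B) where
      open AltWalk W
      open-start-deg : deg d (E N) (w 0) ≡ 1 → ∀ (F : ArcSet N) → SubArcs N F (E N) →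
        deg d F (w 0) ≡ b2n (on F (walkArcℕ d w 0))
      open-start-deg q F sub = trans (count-single _ (adj d (E N) (w 0)) (w 1) (adj-mono d F (E N) sub (w 0))
          (λ y hy → count≡1-unique (adj d (E N) (w 0)) q y (w 1) hy (first-arc mx W))) (cong b2n (adj-forward mx W F 0))


    module Ends {B : ArcSet N} (mx : IsMaximalZigZagTrail N B) (W : AltWalk N B) where
      open AltWalk W
      m1 = m ∸ 1
      sm1 : suc m1 ≡ m
      sm1 = suc-∸1 (length≥1 mx W)

      open-start-deg = StartEnd.open-start-deg mx W

      open-end-deg : deg (alt d m) (E N) (w m) ≡ 1 → ∀ (F : ArcSet N) → SubArcs N F (E N) →
        deg (alt d m) F (w m) ≡ b2n (on F (walkArcℕ d w m1))
      open-end-deg q F sub = trans (StartEnd.open-start-deg mx (rev W) q F sub) (cong (λ t → b2n (on F t)) (revArc W 0 (length≥1 mx W)))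

      module _ (cl : Closed W) where
        altm : alt d m ≡ d
        altm = alt-even-period d m (proj₁ cl)
        arcm1 : walkArcℕ d w m1 ≡ pair d (w 0) (w m1)
        arcm1 = trans (walkArcℕ-suc d w m1) (trans (cong (λ t → pair (alt d t) (w t) (w m1)) sm1)
                  (cong₂ (λ a b → pair a b (w m1)) altm (proj₂ (proj₂ cl))))
        nbm : ∀ (F : ArcSet N) → adj d F (w 0) (w m1) ≡ on F (walkArcℕ d w m1)
        nbm F = trans (sym (adj-pair d F (w 0) (w m1))) (cong (on F) (sym arcm1))
        m1<m : m1 < m
        m1<m = ≤-reflexive sm1
        cl-distinct : ¬ w 1 ≡ w m1
        cl-distinct e = bad (inj 0 m1 (length≥1 mx W) m1<m (trans (cong (pair d (w 0)) e) (sym arcm1)))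
          where
          bad : ¬ 0 ≡ m1
          bad z with s≤s () ← subst (4 ≤_) (trans (sym sm1) (cong suc (sym z))) (proj₁ (proj₂ cl))
        cl-h1 : adj d (E N) (w 0) (w m1) ≡ true
        cl-h1 = trans (nbm (E N)) (trail-arc∈E mx W m1 m1<m)
        cl-exact : ∀ z → adj d (E N) (w 0) z ≡ true → z ≡ w m1 ⊎ z ≡ w 1
        cl-exact z h with z ≟ w m1 | z ≟ w 1
        ... | yes p | _ = inj₁ p
        ... | no _ | yes p = inj₂ p
        ... | no n1 | no n2 = ⊥-elim (¬3≤2 (≤-trans (count-≥3 _ (w m1) (w 1) z (λ e → cl-distinct (sym e))
                (λ e → n1 (sym e)) (λ e → n2 (sym e)) cl-h1 (first-arc mx W) h) (deg≤2 d (w 0))))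
        closed-start-deg : ∀ (F : ArcSet N) → SubArcs N F (E N) →
          deg d F (w 0) ≡ b2n (on F (walkArcℕ d w m1)) + b2n (on F (walkArcℕ d w 0))
        closed-start-deg F sub = trans (count-pair _ _ (w m1) (w 1) (λ e → cl-distinct (sym e)) (adj-mono d F (E N) sub (w 0)) cl-exact)
          (cong₂ _+_ (cong b2n (nbm F)) (cong b2n (adj-forward mx W F 0)))
        closed-start-deg≥2 : 2 ≤ deg d (E N) (w 0)
        closed-start-deg≥2 = count-≥2 _ (w m1) (w 1) (λ e → cl-distinct (sym e)) cl-h1 (first-arc mx W)


module ZeroOneConstraints where

  open Counting using (b2n)
  open AlternatingWalks using (even; alt≡even; alt-not; even-double; parity)

  -- The condition a subdivision tree imposes on the degree n of a vertex on side s.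
  Admissible : Bool → ℕ → Set
  Admissible false n = n ≡ 1
  Admissible true n = 1 ≤ n

  Admissible-1 : ∀ s → Admissible s 1
  Admissible-1 false = refl
  Admissible-1 true = s≤s z≤n

  Admissible-bit : ∀ s b → Admissible s (b2n b) → b ≡ true
  Admissible-bit false true _ = refl
  Admissible-bit true true _ = refl
  Admissible-bit false false ()
  Admissible-bit true false ()

  -- x j is the bit of the j-th arc of a walk; the interior vertex suc j meets arcs j and
  -- suc j, on side alt d (suc j).
  InteriorOK : Bool → ℕ → (ℕ → Bool) → Set
  InteriorOK d m x = ∀ j → suc j < m → Admissible (alt d (suc j)) (b2n (x j) + b2n (x (suc j)))

  FenceOK : Bool → ℕ → (ℕ → Bool) → Set
  FenceOK d m x = InteriorOK d m x × x 0 ≡ true × x (m ∸ 1) ≡ true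

  CrownOK : Bool → ℕ → (ℕ → Bool) → Set
  CrownOK d m x = InteriorOK d m x × Admissible d (b2n (x (m ∸ 1)) + b2n (x 0))

  admissible-step-forward : ∀ s a b → Admissible s (b2n a + b2n b) → (s ≡ true → a ≡ false) → b ≡ not a
  admissible-step-forward false true true () _
  admissible-step-forward false true false _ _ = refl
  admissible-step-forward false false true _ _ = refl
  admissible-step-forward false false false () _
  admissible-step-forward true true b _ h with () ← h refl
  admissible-step-forward true false true _ _ = refl
  admissible-step-forward true false false () _

  admissible-step-backward : ∀ s a b → Admissible s (b2n a + b2n b) → (s ≡ true → b ≡ false) → a ≡ not b
  admissible-step-backward false true true () _
  admissible-step-backward false true false _ _ = refl
  admissible-step-backward false false true _ _ = refl
  admissible-step-backward false false false () _
  admissible-step-backward true a true _ h with () ← h refl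
  admissible-step-backward true true false _ _ = refl
  admissible-step-backward true false false () _

  Alternating : (ℕ → Bool) → Set
  Alternating f = ∀ j → f (suc j) ≡ not (f j)

  even-alternating : Alternating even
  even-alternating j = refl

  odd-alternating : Alternating (λ j → not (even j))
  odd-alternating j = refl

  -- At a head consecutive bits differ, and so they do at a tail whose earlier bit is 0;
  -- hence agreement with an alternating pattern propagates along the walk.
  propagate-forward : ∀ d m x f → Alternating f → ∀ j0 → x j0 ≡ f j0 → InteriorOK d m x →
    (∀ j → suc j < m → alt d (suc j) ≡ true → f j ≡ false) → ∀ t → j0 + t < m → x (j0 + t) ≡ f (j0 + t)
  propagate-forward d m x f af j0 x0 io side zero _ = subst (λ k → x k ≡ f k) (sym (+-identityʳ j0)) x0
  propagate-forward d m x f af j0 x0 io side (suc t) lt =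
    subst (λ k → x k ≡ f k) (sym (+-suc j0 t))
     (trans (admissible-step-forward _ _ _ (io (j0 + t) lt') (λ h → trans ih (side _ lt' h))) (trans (cong not ih) (sym (af _))))
    where
    lt' : suc (j0 + t) < m
    lt' = subst (_< m) (+-suc j0 t) lt
    ih : x (j0 + t) ≡ f (j0 + t)
    ih = propagate-forward d m x f af j0 x0 io side t (<-trans (n<1+n _) lt')

  propagate-from-start : ∀ d m x f → Alternating f → x 0 ≡ f 0 → InteriorOK d m x →
    (∀ j → suc j < m → alt d (suc j) ≡ true → f j ≡ false) → ∀ j → j < m → x j ≡ f j
  propagate-from-start d m x f af x0 io side j j< = propagate-forward d m x f af 0 x0 io side j j<

  propagate-from-end : ∀ d m x f → Alternating f → x (m ∸ 1) ≡ f (m ∸ 1) → InteriorOK d m x →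
    (∀ j → suc j < m → alt d (suc j) ≡ true → f (suc j) ≡ false) → ∀ j → j < m → x j ≡ f j
  propagate-from-end d m x f af xm io side j j< = go (m ∸ 1 ∸ j) j (m+[n∸m]≡n (≤-pred' j<)) j<
    where
    ≤-pred' : ∀ {j m} → j < m → j ≤ m ∸ 1
    ≤-pred' {j} {suc m} (s≤s h) = h
    go : ∀ t j → j + t ≡ m ∸ 1 → j < m → x j ≡ f j
    go zero j e j< = subst (λ k → x k ≡ f k) (sym (trans (sym (+-identityʳ j)) e)) xm
    go (suc t) j e j< = trans (admissible-step-backward _ _ _ (io j sj<) (λ h → trans ih (side j sj< h))) (trans (cong not ih) (trans (cong not (af j)) (not-involutive _)))
      where
      e' : suc j + t ≡ m ∸ 1
      e' = trans (sym (+-suc j t)) e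
      sj<' : suc j ≤ m ∸ 1
      sj<' = subst (suc j ≤_) e' (m≤m+n (suc j) t)
      sj< : suc j < m
      sj< = lt sj<' (≤-trans (s≤s z≤n) j<)
        where
        lt : ∀ {a m} → a ≤ m ∸ 1 → 0 < m → a < m
        lt {m = suc m} h _ = s≤s h
      ih : x (suc j) ≡ f (suc j)
      ih = go t (suc j) e' sj<

  b2n-alt : ∀ a → b2n a + b2n (not a) ≡ 1
  b2n-alt true = refl
  b2n-alt false = refl

  alternating⇒InteriorOK : ∀ d m x f → Alternating f → (∀ j → j < m → x j ≡ f j) → InteriorOK d m x
  alternating⇒InteriorOK d m x f af h j j< = subst (Admissible (alt d (suc j))) (sym (trans (cong₂ (λ a b → b2n a + b2n b) (h j (<-trans (n<1+n j) j<)) (h (suc j) j<))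
    (trans (cong (λ b → b2n (f j) + b2n b) (af j)) (b2n-alt (f j))))) (Admissible-1 _)

  notF : ∀ {b} → not b ≡ false → b ≡ true
  notF {true} _ = refl

  notT : ∀ {b} → not b ≡ true → b ≡ false
  notT {false} _ = refl

  odd-pred : ∀ m → even m ≡ false → even (m ∸ 1) ≡ true × 1 ≤ m
  odd-pred (suc m) e = notF e , s≤s z≤n

  even-pred : ∀ m → even m ≡ true → 1 ≤ m → even (m ∸ 1) ≡ false
  even-pred (suc m) e _ = notT e

  sideT-ev : ∀ j → alt true (suc j) ≡ true → even j ≡ false
  sideT-ev j h = notT (trans (sym (alt≡even false j)) h)

  sideF-ev : ∀ j → alt false (suc j) ≡ true → even (suc j) ≡ false
  sideF-ev j h = cong not (trans (sym (alt≡even true j)) h)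

  sideF-nev : ∀ j → alt false (suc j) ≡ true → not (even j) ≡ false
  sideF-nev j h = cong not (trans (sym (alt≡even true j)) h)

  sideT-nev : ∀ j → alt true (suc j) ≡ true → not (even (suc j)) ≡ false
  sideT-nev j h = trans (not-involutive _) (notT (trans (sym (alt≡even false j)) h))

  oddFence⇒ : ∀ d m x → even m ≡ false → FenceOK d m x → ∀ j → j < m → x j ≡ even j
  oddFence⇒ true m x e (io , x0 , xm) = propagate-from-start true m x even even-alternating x0 io (λ j _ → sideT-ev j)
  oddFence⇒ false m x e (io , x0 , xm) = propagate-from-end false m x even even-alternating (trans xm (sym (proj₁ (odd-pred m e)))) io (λ j _ → sideF-ev j)

  oddFence⇐ : ∀ d m x → even m ≡ false → (∀ j → j < m → x j ≡ even j) → FenceOK d m x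
  oddFence⇐ d m x e h = alternating⇒InteriorOK d m x even even-alternating h , h 0 (proj₂ (odd-pred m e)) ,
    trans (h (m ∸ 1) (m∸1< (proj₂ (odd-pred m e)))) (proj₁ (odd-pred m e))
    where
    m∸1< : ∀ {m} → 1 ≤ m → m ∸ 1 < m
    m∸1< {suc m} _ = ≤-refl

  m∸1<m : ∀ {m} → 1 ≤ m → m ∸ 1 < m
  m∸1<m {suc m} _ = ≤-refl

  ¬FenceOK-W : ∀ m x → even m ≡ true → 1 ≤ m → FenceOK true m x → ⊥
  ¬FenceOK-W m x e m1 (io , x0 , xm) with trans (sym xm) (trans (propagate-from-start true m x even even-alternating x0 io (λ j _ → sideT-ev j) (m ∸ 1) (m∸1<m m1)) (even-pred m e m1))
  ... | ()

  vcT : ∀ a → Admissible true (b2n a + b2n false) → a ≡ true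
  vcT true _ = refl

  vcF : ∀ a → Admissible false (b2n a + b2n true) → a ≡ false
  vcF false _ = refl

  crown⇒ : ∀ d m x → even m ≡ true → 2 ≤ m → CrownOK d m x →
    (∀ j → j < m → x j ≡ even j) ⊎ (∀ j → j < m → x j ≡ not (even j))
  crown⇒ true m x e m2 (io , cl) with x 0 in q0
  ... | true = inj₁ (propagate-from-start true m x even even-alternating q0 io (λ j _ → sideT-ev j))
  ... | false = inj₂ (propagate-from-end true m x (λ j → not (even j)) odd-alternating (trans xm1 (sym (cong not (even-pred m e (≤-trans (s≤s z≤n) m2))))) io (λ j _ → sideT-nev j))
    where
    xm1 : x (m ∸ 1) ≡ true
    xm1 = vcT _ cl
  crown⇒ false m x e m2 (io , cl) with x 0 in q0
  ... | true = inj₁ (propagate-from-end false m x even even-alternating (trans xm1 (sym (even-pred m e (≤-trans (s≤s z≤n) m2)))) io (λ j _ → sideF-ev j))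
    where
    xm1 : x (m ∸ 1) ≡ false
    xm1 = vcF _ cl
  ... | false = inj₂ (propagate-from-start false m x (λ j → not (even j)) odd-alternating q0 io (λ j _ → sideF-nev j))

  crown⇐ : ∀ d m x → even m ≡ true → 2 ≤ m →
    ((∀ j → j < m → x j ≡ even j) ⊎ (∀ j → j < m → x j ≡ not (even j))) → CrownOK d m x
  crown⇐ d m x e m2 (inj₁ h) = alternating⇒InteriorOK d m x even even-alternating h ,
    subst (Admissible d) (sym (cong₂ (λ a b → b2n a + b2n b) (trans (h (m ∸ 1) (m∸1<m m1)) (even-pred m e m1)) (h 0 m1))) (Admissible-1 d)
    where m1 = ≤-trans (s≤s z≤n) m2
  crown⇐ d m x e m2 (inj₂ h) = alternating⇒InteriorOK d m x (λ j → not (even j)) odd-alternating h ,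
    subst (Admissible d) (sym (cong₂ (λ a b → b2n a + b2n b) (trans (h (m ∸ 1) (m∸1<m m1)) (cong not (even-pred m e m1))) (h 0 m1))) (Admissible-1 d)
    where m1 = ≤-trans (s≤s z≤n) m2

  -- The j-th bit of 1 (01)^p (10)^q 1 with t = 2p: it agrees with even j up to t, and with
  -- its negation afterwards.
  mPattern : ℕ → ℕ → Bool
  mPattern t j = if ⌊ j ≤? t ⌋ then even j else not (even j)

  mPattern-ss : ∀ t j → mPattern (suc (suc t)) (suc (suc j)) ≡ mPattern t j
  mPattern-ss t j with j ≤? t | suc (suc j) ≤? suc (suc t)
  ... | yes _ | yes _ = not-involutive _
  ... | no _ | no _ = cong not (not-involutive _)
  ... | yes p | no q = ⊥-elim (q (s≤s (s≤s p)))
  ... | no p | yes q = ⊥-elim (p (s≤s⁻¹ (s≤s⁻¹ q)))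

  mPattern-0 : ∀ t → mPattern t 0 ≡ true
  mPattern-0 t with 0 ≤? t
  ... | yes _ = refl
  ... | no n = ⊥-elim (n z≤n)

  mPattern-lo : ∀ t j → j ≤ t → mPattern t j ≡ even j
  mPattern-lo t j h with j ≤? t
  ... | yes _ = refl
  ... | no n = ⊥-elim (n h)

  mPattern-hi : ∀ t j → ¬ j ≤ t → mPattern t j ≡ not (even j)
  mPattern-hi t j h with j ≤? t
  ... | yes p = ⊥-elim (h p)
  ... | no _ = refl

  evenFence⇐ : ∀ p q x → let m = suc (suc ((p + q) + (p + q))) in
    (∀ j → j < m → x j ≡ mPattern (p + p) j) → FenceOK false m x
  evenFence⇐ p q x h = io , trans (h 0 (s≤s z≤n)) (mPattern-0 t) , trans (h (m ∸ 1) ≤-refl) xm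
    where
    t = p + p
    n = p + q
    m = suc (suc (n + n))
    xm : mPattern t (suc (n + n)) ≡ true
    xm = trans (mPattern-hi t (suc (n + n)) λ le → 1+n≰n (≤-trans (s≤s (+-mono-≤ (m≤m+n p q) (m≤m+n p q))) le))
               (trans (not-involutive _) (even-double n))
    pattern-admissible : ∀ j → Dec (j ≤ t) → Dec (suc j ≤ t) → Admissible (alt false (suc j)) (b2n (mPattern t j) + b2n (mPattern t (suc j)))
    pattern-admissible j (yes a) (yes b) = subst (Admissible _) (sym (trans (cong₂ (λ u v → b2n u + b2n v) (mPattern-lo t j a) (mPattern-lo t (suc j) b)) (b2n-alt (even j)))) (Admissible-1 _)
    pattern-admissible j (no a) (no b) = subst (Admissible _) (sym (trans (cong₂ (λ u v → b2n u + b2n v) (mPattern-hi t j a) (mPattern-hi t (suc j) b)) (b2n-alt (not (even j))))) (Admissible-1 _)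
    pattern-admissible j (no a) (yes b) = ⊥-elim (a (≤-trans (n≤1+n j) b))
    pattern-admissible j (yes a) (no b) = subst (λ k → Admissible (alt false (suc k)) (b2n (mPattern t k) + b2n (mPattern t (suc k)))) (sym jt) at-turn
      where
      jt : j ≡ t
      jt = ≤-antisym a (s≤s⁻¹ (≰⇒> b))
      at-turn : Admissible (alt false (suc t)) (b2n (mPattern t t) + b2n (mPattern t (suc t)))
      at-turn rewrite mPattern-lo t t ≤-refl | mPattern-hi t (suc t) (λ le → 1+n≰n le) | not-involutive (even t) | even-double p | alt≡even true t | even-double p = s≤s z≤n
    io : InteriorOK false m x
    io j j< = subst (Admissible (alt false (suc j))) (sym (cong₂ (λ u v → b2n u + b2n v) (h j (<-trans (n<1+n j) j<)) (h (suc j) j<)))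
      (pattern-admissible j (j ≤? t) (suc j ≤? t))

  evenFence⇒ : ∀ n x → FenceOK false (suc (suc (n + n))) x →
    Σ ℕ λ p → Σ ℕ λ q → p + q ≡ n × (∀ j → j < suc (suc (n + n)) → x j ≡ mPattern (p + p) j)
  evenFence⇒ n x (io , x0 , xm) with x 1 in q1
  ... | true = 0 , n , refl , pw
    where
    f1 : ∀ t → 1 + t < suc (suc (n + n)) → x (1 + t) ≡ not (even (1 + t))
    f1 = propagate-forward false (suc (suc (n + n))) x (λ j → not (even j)) odd-alternating 1 q1 io (λ j _ → sideF-nev j)
    pw : ∀ j → j < suc (suc (n + n)) → x j ≡ mPattern 0 j
    pw zero _ = trans x0 (sym (mPattern-0 0))
    pw (suc j) j< = trans (f1 j j<) (sym (mPattern-hi 0 (suc j) (λ ())))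
  evenFence⇒ zero x (io , x0 , xm) | false with () ← trans (sym q1) xm
  evenFence⇒ (suc n') x (io , x0 , xm) | false with evenFence⇒ n' x' (io' , x2 , xm')
    where
    m' = suc (suc (n' + n'))
    x' : ℕ → Bool
    x' k = x (suc (suc k))
    x2 : x 2 ≡ true
    x2 = trans (admissible-step-forward false (x 1) (x 2) (io 1 (s≤s (s≤s (s≤s z≤n)))) (λ ())) (cong not q1)
    io' : InteriorOK false m' x'
    io' j j< = io (suc (suc j)) (s≤s (s≤s (s≤s (subst (suc j ≤_) (sym (+-suc n' n')) (s≤s⁻¹ j<)))))
    xm' : x' (m' ∸ 1) ≡ true
    xm' = trans (cong x (cong suc (cong suc (sym (+-suc n' n'))))) xm
  ... | p' , q , e , pw' = suc p' , q , cong suc e , pw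
    where
    pw : ∀ j → j < suc (suc (suc n' + suc n')) → x j ≡ mPattern (suc p' + suc p') j
    pw zero _ = trans x0 (sym (mPattern-0 (suc p' + suc p')))
    pw (suc zero) _ = trans q1 (sym (mPattern-lo (suc p' + suc p') 1 (s≤s z≤n)))
    pw (suc (suc j)) j< = trans (pw' j (subst (suc j ≤_) (cong suc (+-suc n' n')) (s≤s⁻¹ (s≤s⁻¹ j<)))) (sym (trans (cong (λ t → mPattern t (suc (suc j))) (cong suc (+-suc p' p'))) (mPattern-ss (p' + p') j)))


module Patterns where

  open AlternatingWalks using (even; even-double; parity)
  open Segments
  open ZeroOneConstraints

  rep-applyFrom : ∀ f → Alternating f → ∀ k s → rep k (f s ∷ f (suc s) ∷ []) ≡ applyFrom f s (k + k)
  rep-applyFrom f af zero s = refl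
  rep-applyFrom f af (suc k) s rewrite +-suc k k = cong (λ l → f s ∷ f (suc s) ∷ l)
    (trans (cong (λ z → rep k z) (sym (cong₂ (λ a b → a ∷ b ∷ []) (f2 s) (f2 (suc s)))))
     (rep-applyFrom f af k (suc (suc s))))
    where
    f2 : ∀ t → f (suc (suc t)) ≡ f t
    f2 t = trans (af (suc t)) (trans (cong not (af t)) (not-involutive _))

  half-even : ∀ k → (k + k) / 2 ≡ k
  half-even zero = refl
  half-even (suc k) = trans (cong (_/ 2) (cong suc (+-suc k k))) (trans (m/n≡1+[m∸n]/n {suc (suc (k + k))} {2} (s≤s (s≤s z≤n))) (cong suc (half-even k)))

  half-odd : ∀ k → suc (k + k) / 2 ≡ k
  half-odd zero = refl
  half-odd (suc k) = trans (cong (_/ 2) (cong suc (cong suc (+-suc k k)))) (trans (m/n≡1+[m∸n]/n {suc (suc (suc (k + k)))} {2} (s≤s (s≤s z≤n))) (cong suc (half-odd k)))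

  mod-even : ∀ k → (k + k) % 2 ≡ 0
  mod-even zero = refl
  mod-even (suc k) = trans (cong (_% 2) (trans (cong suc (+-suc k k)) (+-comm 2 (k + k)))) (trans ([m+n]%n≡m%n (k + k) 2) (mod-even k))

  mod-odd : ∀ k → suc (k + k) % 2 ≡ 1
  mod-odd zero = refl
  mod-odd (suc k) = trans (cong (_% 2) (trans (cong suc (cong suc (+-suc k k))) (+-comm 2 (suc (k + k))))) (trans ([m+n]%n≡m%n (suc (k + k)) 2) (mod-odd k))

  even⇒%2≡0 : ∀ m → even m ≡ true → m % 2 ≡ 0
  even⇒%2≡0 m e with parity m
  ... | k , inj₁ (p , _) = trans (cong (_% 2) p) (mod-even k)
  ... | k , inj₂ (p , q) with () ← trans (sym e) q

  odd⇒%2≡1 : ∀ m → even m ≡ false → m % 2 ≡ 1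
  odd⇒%2≡1 m e with parity m
  ... | k , inj₂ (p , _) = trans (cong (_% 2) p) (mod-odd k)
  ... | k , inj₁ (p , q) with () ← trans (sym e) q

  %2≡0⇒even : ∀ m → m % 2 ≡ 0 → even m ≡ true
  %2≡0⇒even m e with parity m
  ... | k , inj₁ (_ , q) = q
  ... | k , inj₂ (p , _) with () ← trans (sym e) (trans (cong (_% 2) p) (mod-odd k))

  %2≡1⇒odd : ∀ m → m % 2 ≡ 1 → even m ≡ false
  %2≡1⇒odd m e with parity m
  ... | k , inj₂ (_ , q) = q
  ... | k , inj₁ (p , _) with () ← trans (sym e) (trans (cong (_% 2) p) (mod-even k))

  applyFrom≡⇒pointwise : ∀ (x f : ℕ → Bool) m m' → applyFrom x 0 m ≡ applyFrom f 0 m' → m ≡ m' → ∀ j → j < m → x j ≡ f j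
  applyFrom≡⇒pointwise x f m .m e refl j j< = subst (λ k → x k ≡ f k) (+-identityʳ j) (applyFrom-injective x f 0 m e j j<)

  pointwise⇒applyFrom≡ : ∀ (x f : ℕ → Bool) m → (∀ j → j < m → x j ≡ f j) → applyFrom x 0 m ≡ applyFrom f 0 m
  pointwise⇒applyFrom≡ x f m h = applyFrom-cong x f 0 m λ i i< → subst (λ k → x k ≡ f k) (sym (+-identityʳ i)) (h i i<)

  TF FT : List Bool
  TF = true ∷ false ∷ []
  FT = false ∷ true ∷ []

  rep-TF : ∀ k → rep k TF ≡ applyFrom even 0 (k + k)
  rep-TF k = rep-applyFrom even even-alternating k 0

  rep-FT : ∀ k → rep k FT ≡ applyFrom (λ j → not (even j)) 0 (k + k)
  rep-FT k = rep-applyFrom (λ j → not (even j)) odd-alternating k 0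

  length-applyFrom : ∀ {l : List Bool} {f s n} → l ≡ applyFrom f s n → length l ≡ n
  length-applyFrom {f = f} {s} {n} refl = applyFrom-length f s n

  crownPattern⇒ : ∀ m (x : ℕ → Bool) → even m ≡ true → ((∀ j → j < m → x j ≡ even j) ⊎ (∀ j → j < m → x j ≡ not (even j))) →
    applyFrom x 0 m ≡ rep (m / 2) TF ⊎ applyFrom x 0 m ≡ rep (m / 2) FT
  crownPattern⇒ m x e h with parity m
  ... | k , inj₂ (_ , q) with () ← trans (sym e) q
  crownPattern⇒ m x e (inj₁ h) | k , inj₁ (p , _) = inj₁ (trans (pointwise⇒applyFrom≡ x even m h)
     (trans (cong (applyFrom even 0) p) (sym (trans (cong (λ t → rep (t / 2) TF) p) (trans (cong (λ t → rep t TF) (half-even k)) (rep-TF k))))))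
  crownPattern⇒ m x e (inj₂ h) | k , inj₁ (p , _) = inj₂ (trans (pointwise⇒applyFrom≡ x _ m h)
     (trans (cong (applyFrom _ 0) p) (sym (trans (cong (λ t → rep (t / 2) FT) p) (trans (cong (λ t → rep t FT) (half-even k)) (rep-FT k))))))

  crownPattern⇐ : ∀ m (x : ℕ → Bool) → (applyFrom x 0 m ≡ rep (m / 2) TF ⊎ applyFrom x 0 m ≡ rep (m / 2) FT) →
    even m ≡ true × ((∀ j → j < m → x j ≡ even j) ⊎ (∀ j → j < m → x j ≡ not (even j)))
  crownPattern⇐ m x (inj₁ e) = subst (λ t → even t ≡ true) (sym len≡) (even-double (m / 2)) ,
    inj₁ (applyFrom≡⇒pointwise x even m _ (trans e (rep-TF (m / 2))) len≡)
    where
    len≡ : m ≡ (m / 2) + (m / 2)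
    len≡ = trans (sym (applyFrom-length x 0 m)) (length-applyFrom (trans e (rep-TF (m / 2))))
  crownPattern⇐ m x (inj₂ e) = subst (λ t → even t ≡ true) (sym len≡) (even-double (m / 2)) ,
    inj₂ (applyFrom≡⇒pointwise x (λ j → not (even j)) m _ (trans e (rep-FT (m / 2))) len≡)
    where
    len≡ : m ≡ (m / 2) + (m / 2)
    len≡ = trans (sym (applyFrom-length x 0 m)) (length-applyFrom (trans e (rep-FT (m / 2))))

  nPattern : ℕ → List Bool
  nPattern m = true ∷ rep ((m ∸ 1) / 2) FT

  nPattern-applyFrom : ∀ k → true ∷ rep k FT ≡ applyFrom even 0 (suc (k + k))
  nPattern-applyFrom k = cong (true ∷_) (rep-applyFrom even even-alternating k 1)

  nPattern⇒ : ∀ m (x : ℕ → Bool) → even m ≡ false → (∀ j → j < m → x j ≡ even j) → applyFrom x 0 m ≡ nPattern m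
  nPattern⇒ m x e h with parity m
  ... | k , inj₁ (_ , q) with () ← trans (sym e) q
  ... | k , inj₂ (p , _) = trans (pointwise⇒applyFrom≡ x even m h) (trans (cong (applyFrom even 0) p)
       (sym (trans (cong (λ t → true ∷ rep ((t ∸ 1) / 2) FT) p) (trans (cong (λ t → true ∷ rep t FT) (half-even k)) (nPattern-applyFrom k)))))

  nPattern⇐ : ∀ m (x : ℕ → Bool) → applyFrom x 0 m ≡ nPattern m → even m ≡ false × (∀ j → j < m → x j ≡ even j)
  nPattern⇐ m x e = subst (λ t → even t ≡ false) (sym len≡) (cong not (even-double ((m ∸ 1) / 2))) , applyFrom≡⇒pointwise x even m _ (trans e (nPattern-applyFrom ((m ∸ 1) / 2))) len≡
    where
    len≡ : m ≡ suc (((m ∸ 1) / 2) + ((m ∸ 1) / 2))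
    len≡ = trans (sym (applyFrom-length x 0 m)) (length-applyFrom (trans e (nPattern-applyFrom ((m ∸ 1) / 2))))

  mPatternList : ℕ → ℕ → List Bool
  mPatternList p q = true ∷ (rep p FT ++ rep q TF ++ true ∷ [])

  even-double+ : ∀ k b → even ((k + k) + b) ≡ even b
  even-double+ zero b = refl
  even-double+ (suc k) b = trans (cong (λ t → not (even (t + b))) (+-suc k k)) (trans (not-involutive _) (even-double+ k b))

  mPatternList-applyFrom : ∀ p q → mPatternList p q ≡ applyFrom (mPattern (p + p)) 0 (suc (suc ((p + q) + (p + q))))
  mPatternList-applyFrom p q = sym (trans (cong (_∷ applyFrom (mPattern t) 1 (suc ((p + q) + (p + q)))) (mPattern-0 t))
    (cong (true ∷_) (trans (cong (applyFrom (mPattern t) 1) L≡) (trans (applyFrom-++ (mPattern t) 1 (p + p) ((q + q) + 1))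
      (cong₂ _++_ part1 (trans (applyFrom-++ (mPattern t) ((p + p) + 1) (q + q) 1) (cong₂ _++_ part2 part3)))))))
    where
    t = p + p
    L≡ : suc ((p + q) + (p + q)) ≡ (p + p) + ((q + q) + 1)
    L≡ = solve 2 (λ p q → con 1 :+ ((p :+ q) :+ (p :+ q)) := (p :+ p) :+ ((q :+ q) :+ con 1)) refl p q
      where open +-*-Solver
    part1 : applyFrom (mPattern t) 1 (p + p) ≡ rep p FT
    part1 = trans (applyFrom-cong (mPattern t) even 1 (p + p) λ i i< → mPattern-lo t (i + 1) (subst (_≤ t) (sym (+-comm i 1)) i<))
       (sym (rep-applyFrom even even-alternating p 1))
    part2 : applyFrom (mPattern t) ((p + p) + 1) (q + q) ≡ rep q TF
    part2 = trans (applyFrom-cong (mPattern t) (λ j → not (even j)) ((p + p) + 1) (q + q) λ i i< → mPattern-hi t (i + (t + 1))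
          λ le → 1+n≰n (subst (_≤ t) (+-comm t 1) (≤-trans (m≤n+m (t + 1) i) le)))
       (trans (sym (rep-applyFrom (λ j → not (even j)) odd-alternating q (t + 1))) (cong (λ z → rep q z) (cong₂ (λ a b → a ∷ b ∷ [])
          (trans (cong (λ z → not (even z)) (+-comm t 1)) (trans (not-involutive _) (even-double p)))
          (trans (cong (λ z → not (not (even z))) (+-comm t 1)) (trans (not-involutive _) (cong not (even-double p)))))))
    part3 : applyFrom (mPattern t) ((q + q) + ((p + p) + 1)) 1 ≡ true ∷ []
    part3 = cong (_∷ []) (trans (mPattern-hi t _ (λ le → 1+n≰n (subst (_≤ t) (+-comm t 1) (≤-trans (m≤n+m (t + 1) (q + q)) le))))
       (cong not (trans (even-double+ q (t + 1)) (even-double+ p 1))))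

  mPatternList⇒ : ∀ p q m (x : ℕ → Bool) → m ≡ suc (suc ((p + q) + (p + q))) → (∀ j → j < m → x j ≡ mPattern (p + p) j) → applyFrom x 0 m ≡ mPatternList p q
  mPatternList⇒ p q m x e h = trans (pointwise⇒applyFrom≡ x _ m h) (trans (cong (applyFrom (mPattern (p + p)) 0) e) (sym (mPatternList-applyFrom p q)))

  mPatternList⇐ : ∀ p q m (x : ℕ → Bool) → applyFrom x 0 m ≡ mPatternList p q → m ≡ suc (suc ((p + q) + (p + q))) × (∀ j → j < m → x j ≡ mPattern (p + p) j)
  mPatternList⇐ p q m x e = len≡ , applyFrom≡⇒pointwise x _ m _ (trans e (mPatternList-applyFrom p q)) len≡
    where
    len≡ : m ≡ suc (suc ((p + q) + (p + q)))
    len≡ = trans (sym (applyFrom-length x 0 m)) (length-applyFrom (trans e (mPatternList-applyFrom p q)))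

  even-form-half : ∀ m n → m ≡ suc (suc (n + n)) → n ≡ (m ∸ 2) / 2
  even-form-half m n e = sym (trans (cong (λ t → (t ∸ 2) / 2) e) (half-even n))

  length-rep-TF : ∀ k → length (rep k TF) ≡ k + k
  length-rep-TF k = length-applyFrom (rep-TF k)
  length-rep-FT : ∀ k → length (rep k FT) ≡ k + k
  length-rep-FT k = length-applyFrom (rep-FT k)
  length-nPattern : ∀ m → length (nPattern m) ≡ suc (((m ∸ 1) / 2) + ((m ∸ 1) / 2))
  length-nPattern m = length-applyFrom (nPattern-applyFrom ((m ∸ 1) / 2))
  length-mPatternList : ∀ p q → length (mPatternList p q) ≡ suc (suc ((p + q) + (p + q)))
  length-mPatternList p q = length-applyFrom (mPatternList-applyFrom p q)

  even-halves : ∀ m → even m ≡ true → (m / 2) + (m / 2) ≡ m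
  even-halves m e with parity m
  ... | k , inj₁ (p , _) = trans (cong (λ t → (t / 2) + (t / 2)) p) (trans (cong (λ t → t + t) (half-even k)) (sym p))
  ... | k , inj₂ (p , q) with () ← trans (sym e) q

  odd-halves : ∀ m → even m ≡ false → suc (((m ∸ 1) / 2) + ((m ∸ 1) / 2)) ≡ m
  odd-halves m e with parity m
  ... | k , inj₂ (p , _) = trans (cong (λ t → suc (((t ∸ 1) / 2) + ((t ∸ 1) / 2))) p) (trans (cong (λ t → suc (t + t)) (half-even k)) (sym p))
  ... | k , inj₁ (p , q) with () ← trans (sym e) q

  even-form : ∀ m → even m ≡ true → 1 ≤ m → Σ ℕ λ n → m ≡ suc (suc (n + n))
  even-form m e m1 with parity m
  ... | k , inj₂ (p , q) with () ← trans (sym e) q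
  even-form m e m1 | zero , inj₁ (p , _) with () ← subst (1 ≤_) p m1
  even-form m e m1 | suc n , inj₁ (p , _) = n , trans p (cong suc (+-suc n n))


module TrailShapes where

  open Counting
  open LocalCharacterisation
  open AlternatingWalks
  open TrailDegrees
  open ZeroOneConstraints
  open Patterns using (%2≡0⇒even; %2≡1⇒odd; even⇒%2≡0; odd⇒%2≡1)

  LocalBySide : (N : Digraph) → ArcSet N → Set
  LocalBySide N A = ∀ s v → 1 ≤ deg s (E N) v → Admissible s (deg s A v)

  Local⇒LocalBySide : ∀ N A → Local N A → LocalBySide N A
  Local⇒LocalBySide N A (i , o) false v h = i v h
  Local⇒LocalBySide N A (i , o) true v h = o v h

  LocalBySide⇒Local : ∀ N A → LocalBySide N A → Local N A
  LocalBySide⇒Local N A l = l false , l true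

  arc-endpoint : ∀ {N B} (W : AltWalk N B) j → j < AltWalk.m W → ∀ s →
    Σ ℕ λ k → k ≤ AltWalk.m W × alt (AltWalk.d W) k ≡ s × AltWalk.w W k ≡ end s (walkArcℕ (AltWalk.d W) (AltWalk.w W) j) × (k ≡ j ⊎ k ≡ suc j)
  arc-endpoint W j j< s with alt (AltWalk.d W) j B≟ s
  ... | yes q = j , <⇒≤ j< , q , sym (trans (cong (λ t → end t (walkArcℕ (AltWalk.d W) (AltWalk.w W) j)) (sym q)) (end-pair (alt (AltWalk.d W) j) _ _)) , inj₁ refl
  ... | no q = suc j , j< , trans (alt-suc (AltWalk.d W) j) (sym (¬-not (λ e → q (sym e)))) ,
       sym (trans (cong (end s) (walkArcℕ-suc (AltWalk.d W) (AltWalk.w W) j))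
         (trans (cong (λ t → end t (pair (alt (AltWalk.d W) (suc j)) (AltWalk.w W (suc j)) (AltWalk.w W j))) (sym (trans (alt-suc (AltWalk.d W) j) (sym (¬-not (λ e → q (sym e)))))))
            (end-pair (alt (AltWalk.d W) (suc j)) (AltWalk.w W (suc j)) (AltWalk.w W j)))) , inj₂ refl

  module Shapes (N : Digraph) (nw : IsRootedBinaryPhyloNetwork N) where
    open TrailDegrees.InNetwork N nw

    AdmissibleAlong : ∀ {B} → AltWalk N B → ArcSet N → Set
    AdmissibleAlong W A = ∀ k → k ≤ AltWalk.m W → Admissible (alt (AltWalk.d W) k) (deg (alt (AltWalk.d W) k) A (AltWalk.w W k))

    bits : ∀ {B} → AltWalk N B → ArcSet N → ℕ → Bool
    bits W A j = on A (walkArcℕ (AltWalk.d W) (AltWalk.w W) j)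

    Open : ∀ {B} → AltWalk N B → Set
    Open W = deg (AltWalk.d W) (E N) (AltWalk.w W 0) ≡ 1 × deg (alt (AltWalk.d W) (AltWalk.m W)) (E N) (AltWalk.w W (AltWalk.m W)) ≡ 1

    module TrailBits {B : ArcSet N} (mx : IsMaximalZigZagTrail N B) (W : AltWalk N B) (A : ArcSet N) (sub : SubArcs N A (E N)) where
      open AltWalk W
      open Ends mx W
      x = bits W A

      LocalBySide⇒AdmissibleAlong : LocalBySide N A → AdmissibleAlong W A
      LocalBySide⇒AdmissibleAlong l zero _ = l d (w 0) (start-deg≥1 mx W)
      LocalBySide⇒AdmissibleAlong l (suc j) sj≤ = l _ _ (count-≥1 _ (w j) (trans (adj-backward mx W (E N) j) (trail-arc∈E mx W j sj≤)))

      AdmissibleAlong⇒InteriorOK : AdmissibleAlong W A → InteriorOK d m x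
      AdmissibleAlong⇒InteriorOK pa j j< = subst (Admissible (alt d (suc j))) (interior-deg mx W A sub j j<) (pa (suc j) (<⇒≤ j<))

      AdmissibleAlong⇒CrownOK : (cl : Closed W) → AdmissibleAlong W A → CrownOK d m x
      AdmissibleAlong⇒CrownOK cl pa = AdmissibleAlong⇒InteriorOK pa , subst (Admissible d) (closed-start-deg cl A sub) (pa 0 z≤n)

      AdmissibleAlong⇒FenceOK : Open W → AdmissibleAlong W A → FenceOK d m x
      AdmissibleAlong⇒FenceOK (n0 , nm) pa = AdmissibleAlong⇒InteriorOK pa ,
        Admissible-bit d (x 0) (subst (Admissible d) (open-start-deg n0 A sub) (pa 0 z≤n)) ,
        Admissible-bit (alt d m) (x m1) (subst (Admissible (alt d m)) (open-end-deg nm A sub) (pa m ≤-refl))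

      InteriorOK⇒admissible : InteriorOK d m x → ∀ j → suc j < m → Admissible (alt d (suc j)) (deg (alt d (suc j)) A (w (suc j)))
      InteriorOK⇒admissible io j j< = subst (Admissible (alt d (suc j))) (sym (interior-deg mx W A sub j j<)) (io j j<)

      CrownOK⇒AdmissibleAlong : (cl : Closed W) → CrownOK d m x → AdmissibleAlong W A
      CrownOK⇒AdmissibleAlong cl (io , e) zero _ = subst (Admissible d) (sym (closed-start-deg cl A sub)) e
      CrownOK⇒AdmissibleAlong cl (io , e) (suc j) sj≤ with suc j <? m
      ... | yes sj< = InteriorOK⇒admissible io j sj<
      ... | no ¬sj< = subst (λ t → Admissible (alt d t) (deg (alt d t) A (w t))) (sym mj)
            (subst₂ (λ s v → Admissible s (deg s A v)) (sym (altm cl)) (sym (proj₂ (proj₂ cl))) (subst (Admissible d) (sym (closed-start-deg cl A sub)) e))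
        where
        mj : suc j ≡ m
        mj = ≤-antisym sj≤ (≮⇒≥ ¬sj<)

      FenceOK⇒AdmissibleAlong : Open W → FenceOK d m x → AdmissibleAlong W A
      FenceOK⇒AdmissibleAlong (n0 , nm) (io , x0 , xm) zero _ = subst (Admissible d) (sym (trans (open-start-deg n0 A sub) (cong b2n x0))) (Admissible-1 d)
      FenceOK⇒AdmissibleAlong (n0 , nm) (io , x0 , xm) (suc j) sj≤ with suc j <? m
      ... | yes sj< = InteriorOK⇒admissible io j sj<
      ... | no ¬sj< = subst (λ t → Admissible (alt d t) (deg (alt d t) A (w t))) (sym mj)
            (subst (Admissible (alt d m)) (sym (trans (open-end-deg nm A sub) (cong b2n xm))) (Admissible-1 _))
        where
        mj : suc j ≡ m
        mj = ≤-antisym sj≤ (≮⇒≥ ¬sj<)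

    AdmissibleAlong⇒LocalBySide : ∀ (A : ArcSet N) →
      (∀ u v → E N u v ≡ true → Σ (ArcSet N) λ B → B u v ≡ true × Σ (AltWalk N B) λ W → AdmissibleAlong W A) → LocalBySide N A
    AdmissibleAlong⇒LocalBySide A cover s v h with count-witness (adj s (E N) v) h
    ... | u , hu with cover (proj₁ (pair s v u)) (proj₂ (pair s v u)) (trans (adj-pair s (E N) v u) hu)
    ... | B , Be , W , pa with AltWalk.cov W _ _ Be
    ... | j , j< , ej with arc-endpoint W j j< s
    ... | k , k≤ , ak , wk , _ = subst₂ (λ s' v' → Admissible s' (deg s' A v')) ak (trans wk (trans (cong (end s) ej) (end-pair s v u))) (pa k k≤)

    module _ {B : ArcSet N} (mx : IsMaximalZigZagTrail N B) where

      closed⇒deg≥2 : (W : AltWalk N B) → Closed W → ∀ k → k ≤ AltWalk.m W → 2 ≤ deg (alt (AltWalk.d W) k) (E N) (AltWalk.w W k)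
      closed⇒deg≥2 W cl zero _ = Ends.closed-start-deg≥2 mx W cl
      closed⇒deg≥2 W cl (suc j) sj≤ with suc j <? AltWalk.m W
      ... | yes sj< = interior-deg≥2 mx W j sj<
      ... | no ¬sj< = subst (λ t → 2 ≤ deg (alt (AltWalk.d W) t) (E N) (AltWalk.w W t)) (sym mj)
            (subst₂ (λ s v → 2 ≤ deg s (E N) v) (sym (Ends.altm mx W cl)) (sym (proj₂ (proj₂ cl))) (Ends.closed-start-deg≥2 mx W cl))
        where
        mj : suc j ≡ AltWalk.m W
        mj = ≤-antisym sj≤ (≮⇒≥ ¬sj<)

      IsCrown⇒closed : IsCrown N B → Σ (AltWalk N B) Closed
      IsCrown⇒closed (m' , v , f4 , md , cls , en) = Wc , %2≡0⇒even m' md , f4 , trans (cong v (clamp-m m')) (trans cls (cong v (sym (clamp-0 m'))))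
        where
        Wc = fromEnumeration {N} {B} m' false v en

      open⇒¬IsCrown : (W : AltWalk N B) → Open W → ¬ IsCrown N B
      open⇒¬IsCrown W (n0 , nm) ic with IsCrown⇒closed ic
      ... | Wc , clc with AltWalk.cov Wc _ _ (AltWalk.mem W 0 (length≥1 mx W))
      ... | jc , jc< , ejc with arc-endpoint Wc jc jc< (AltWalk.d W)
      ... | k , k≤ , ak , wk , _ = 1+n≰n (subst (2 ≤_) n0 (subst₂ (λ s v → 2 ≤ deg s (E N) v) ak
               (trans wk (trans (cong (end (AltWalk.d W)) ejc) (end-pair (AltWalk.d W) _ _))) (closed⇒deg≥2 Wc clc k k≤)))

      open-forward⇒¬IsMFence : (W : AltWalk N B) → Open W → AltWalk.d W ≡ true → ¬ IsMFence N B
      open-forward⇒¬IsMFence W (n0 , nm) dq (_ , m' , v , m2 , md , en) with AltWalk.cov (fromEnumeration {N} {B} m' false v en) (proj₁ (walkArcℕ (AltWalk.d W) (AltWalk.w W) 0)) (proj₂ (walkArcℕ (AltWalk.d W) (AltWalk.w W) 0)) (AltWalk.mem W 0 (length≥1 mx W))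
      ... | jc , jc< , ejc with arc-endpoint (fromEnumeration {N} {B} m' false v en) jc jc< true
      ... | zero , k≤ , () , wk , _
      ... | suc j , k≤ , ak , wk , _ with suc j <? m'
      ... | yes sj< = 1+n≰n (subst (2 ≤_) (trans (sym (cong (λ t → deg t (E N) (AltWalk.w W 0)) dq)) n0)
               (subst₂ (λ s u → 2 ≤ deg s (E N) u) ak (trans wk (trans (cong (end true) ejc) e0)) (interior-deg≥2 mx (fromEnumeration {N} {B} m' false v en) j sj<)))
        where
        e0 : end true (walkArcℕ (AltWalk.d W) (AltWalk.w W) 0) ≡ AltWalk.w W 0
        e0 = trans (cong (λ t → end true (pair t (AltWalk.w W 0) (AltWalk.w W 1))) dq) refl
      ... | no ¬sj< = false≢true (trans (sym (subst (λ t → alt false t ≡ false) (sym mj) (trans (alt≡even false m') (cong not (%2≡0⇒even m' md))))) ak)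
        where
        mj : suc j ≡ m'
        mj = ≤-antisym k≤ (≮⇒≥ ¬sj<)

    AltWalk-length-≤ : ∀ {B} (W W' : AltWalk N B) → AltWalk.m W ≤ AltWalk.m W'
    AltWalk-length-≤ {B} W W' = injective⇒≤ {f = f} finj
      where
      a = walkArcℕ (AltWalk.d W) (AltWalk.w W)
      a' = walkArcℕ (AltWalk.d W') (AltWalk.w W')
      c : (j : Fin (AltWalk.m W)) → Σ ℕ λ i → i < AltWalk.m W' × a' i ≡ (proj₁ (a (toℕ j)) , proj₂ (a (toℕ j)))
      c j = AltWalk.cov W' _ _ (AltWalk.mem W (toℕ j) (toℕ<n j))
      f : Fin (AltWalk.m W) → Fin (AltWalk.m W')
      f j = fromℕ< (proj₁ (proj₂ (c j)))
      finj : ∀ {j k} → f j ≡ f k → j ≡ k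
      finj {j} {k} e = toℕ-injective (AltWalk.inj W _ _ (toℕ<n j) (toℕ<n k)
         (trans (sym (proj₂ (proj₂ (c j)))) (trans (cong a' ii) (proj₂ (proj₂ (c k))))))
        where
        ii : proj₁ (c j) ≡ proj₁ (c k)
        ii = trans (sym (toℕ-fromℕ< (proj₁ (proj₂ (c j))))) (trans (cong toℕ e) (toℕ-fromℕ< (proj₁ (proj₂ (c k)))))

    AltWalk-length-unique : ∀ {B} (W W' : AltWalk N B) → AltWalk.m W ≡ AltWalk.m W'
    AltWalk-length-unique W W' = ≤-antisym (AltWalk-length-≤ W W') (AltWalk-length-≤ W' W)

    -- IsCrown wants the first arc backward; a closed walk starting forward is rotated by one.
    module Rotate {B : ArcSet N} (W : AltWalk N B) (dq : AltWalk.d W ≡ true) (cl : Closed W) where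
      open AltWalk W
      m>0 : 0 < m
      m>0 = ≤-trans (s≤s z≤n) (proj₁ (proj₂ cl))
      rotatedVertex : ∀ k → Dec (k ≡ m) → Fin (V N)
      rotatedVertex k (yes _) = w 1
      rotatedVertex k (no _) = w (suc k)
      rotated : ℕ → Fin (V N)
      rotated k = rotatedVertex k (k ℕ.≟ m)
      rotatedVertex-no : ∀ k (dk : Dec (k ≡ m)) → ¬ k ≡ m → rotatedVertex k dk ≡ w (suc k)
      rotatedVertex-no k (yes p) n = ⊥-elim (n p)
      rotatedVertex-no k (no _) n = refl
      rotatedVertex-yes : ∀ k (dk : Dec (k ≡ m)) → k ≡ m → rotatedVertex k dk ≡ w 1
      rotatedVertex-yes k (yes _) _ = refl
      rotatedVertex-yes k (no n) p = ⊥-elim (n p)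
      rotated-< : ∀ k → k < m → rotated k ≡ w (suc k)
      rotated-< k k< = rotatedVertex-no k (k ℕ.≟ m) (<⇒≢ k<)
      rotated-m : rotated m ≡ w 1
      rotated-m = rotatedVertex-yes m (m ℕ.≟ m) refl
      shiftIndex : ∀ j → Dec (suc j < m) → ℕ
      shiftIndex j (yes _) = suc j
      shiftIndex j (no _) = 0
      shift : ℕ → ℕ
      shift j = shiftIndex j (suc j <? m)
      rotated-arc′ : ∀ j → j < m → (dj : Dec (suc j < m)) → walkArcℕ false rotated j ≡ walkArcℕ d w (shiftIndex j dj)
      rotated-arc′ j j< (yes sj<) = trans (cong₂ (pair (alt false j)) (rotated-< j j<) (rotated-< (suc j) sj<))
         (cong (λ t → pair (alt t (suc j)) (w (suc j)) (w (suc (suc j)))) (sym dq))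
      rotated-arc′ j j< (no ¬sj<) = trans (cong₂ (pair (alt false j)) (trans (rotated-< j j<) (trans (cong w mj) (proj₂ (proj₂ cl))))
           (trans (cong rotated mj) rotated-m))
         (trans (cong (λ t → pair t (w 0) (w 1)) aj) (cong (λ t → pair t (w 0) (w 1)) (sym dq)))
        where
        mj : suc j ≡ m
        mj = ≤-antisym j< (≮⇒≥ ¬sj<)
        aj : alt false j ≡ true
        aj = trans (alt≡even false j) (cong not (notT (trans (cong even mj) (proj₁ cl))))
      rotated-arc : ∀ j → j < m → walkArcℕ false rotated j ≡ walkArcℕ d w (shift j)
      rotated-arc j j< = rotated-arc′ j j< (suc j <? m)
      shiftIndex< : ∀ j (dj : Dec (suc j < m)) → shiftIndex j dj < m
      shiftIndex< j (yes p) = p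
      shiftIndex< j (no _) = m>0
      shiftIndex-injective : ∀ j k → j < m → k < m → (dj : Dec (suc j < m)) (dk : Dec (suc k < m)) → shiftIndex j dj ≡ shiftIndex k dk → j ≡ k
      shiftIndex-injective j k _ _ (yes _) (yes _) e = suc-injective e
      shiftIndex-injective j k j< k< (no a) (no b) e = suc-injective (trans (≤-antisym j< (≮⇒≥ a)) (sym (≤-antisym k< (≮⇒≥ b))))
      shiftIndex-injective j k _ _ (yes _) (no _) ()
      shiftIndex-injective j k _ _ (no _) (yes _) ()
      shiftIndex-no : ∀ j (dj : Dec (suc j < m)) → ¬ suc j < m → shiftIndex j dj ≡ 0
      shiftIndex-no j (yes p) n = ⊥-elim (n p)
      shiftIndex-no j (no _) _ = refl
      shiftIndex-yes : ∀ j (dj : Dec (suc j < m)) → suc j < m → shiftIndex j dj ≡ suc j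
      shiftIndex-yes j (yes _) _ = refl
      shiftIndex-yes j (no n) p = ⊥-elim (n p)
      shift-surjective : ∀ i → i < m → Σ ℕ λ j → j < m × shift j ≡ i
      shift-surjective zero i< = m ∸ 1 , subst (m ∸ 1 <_) (suc-∸1 m>0) ≤-refl ,
        shiftIndex-no (m ∸ 1) _ (λ p → 1+n≰n (subst (_≤ m) (cong suc (suc-∸1 m>0)) p))
      shift-surjective (suc i) i< = i , <-trans (n<1+n i) i< , shiftIndex-yes i _ i<
      rotatedWalk : AltWalk N B
      rotatedWalk = record { m = m ; d = false ; w = rotated ; inj = i' ; cov = c' ; mem = me' }
        where
        i' : ∀ j k → j < m → k < m → walkArcℕ false rotated j ≡ walkArcℕ false rotated k → j ≡ k
        i' j k j< k< e = shiftIndex-injective j k j< k< _ _ (inj _ _ (shiftIndex< j (suc j <? m)) (shiftIndex< k (suc k <? m)) (trans (sym (rotated-arc j j<)) (trans e (rotated-arc k k<))))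
        c' : ∀ a b → B a b ≡ true → Σ ℕ λ j → j < m × walkArcℕ false rotated j ≡ (a , b)
        c' a b h with cov a b h
        ... | i , i< , ei with shift-surjective i i<
        ... | j , j< , rj = j , j< , trans (rotated-arc j j<) (trans (cong (walkArcℕ d w) rj) ei)
        me' : ∀ j → j < m → on B (walkArcℕ false rotated j) ≡ true
        me' j j< = trans (cong (on B) (rotated-arc j j<)) (mem (shift j) (shiftIndex< j (suc j <? m)))
      rotated-closed : Closed rotatedWalk
      rotated-closed = proj₁ cl , proj₁ (proj₂ cl) , trans rotated-m (sym (rotated-< 0 m>0))

    closed-backward⇒IsCrown : ∀ {B} (W : AltWalk N B) → AltWalk.d W ≡ false → Closed W → IsCrown N B
    closed-backward⇒IsCrown W dq cl = AltWalk.m W , (λ k → AltWalk.w W (toℕ k)) , proj₁ (proj₂ cl) , even⇒%2≡0 (AltWalk.m W) (proj₁ cl) ,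
      trans (cong (AltWalk.w W) (toℕ-fromℕ (AltWalk.m W))) (proj₂ (proj₂ cl)) ,
      subst (λ t → Enumerates N _ (walkArc t (λ k → AltWalk.w W (toℕ k)))) dq (toEnumeration W)

    closed⇒IsCrown : ∀ {B} (W : AltWalk N B) → Closed W → IsCrown N B
    closed⇒IsCrown W cl with AltWalk.d W B≟ false
    ... | yes dq = closed-backward⇒IsCrown W dq cl
    ... | no ndq = closed-backward⇒IsCrown (Rotate.rotatedWalk W (¬-not ndq) cl) refl (Rotate.rotated-closed W (¬-not ndq) cl)

    odd-forward⇒IsNFence : ∀ {B} (W : AltWalk N B) → AltWalk.d W ≡ true → even (AltWalk.m W) ≡ false → ¬ IsCrown N B → IsNFence N B
    odd-forward⇒IsNFence W dq e nc = nc , AltWalk.m W , (λ k → AltWalk.w W (toℕ k)) , odd⇒%2≡1 (AltWalk.m W) e ,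
      subst (λ t → Enumerates N _ (walkArc t (λ k → AltWalk.w W (toℕ k)))) dq (toEnumeration W)

    odd⇒IsNFence : ∀ {B} (W : AltWalk N B) → even (AltWalk.m W) ≡ false → ¬ IsCrown N B → IsNFence N B
    odd⇒IsNFence W e nc with AltWalk.d W B≟ true
    ... | yes dq = odd-forward⇒IsNFence W dq e nc
    ... | no ndq = odd-forward⇒IsNFence (rev W) (trans (cong (λ t → alt t (AltWalk.m W)) (¬-not ndq)) (trans (alt≡even false (AltWalk.m W)) (cong not e))) e nc

    even⇒IsMFence : ∀ {B} (W : AltWalk N B) → even (AltWalk.m W) ≡ true → AltWalk.d W ≡ false → 1 ≤ AltWalk.m W → ¬ IsCrown N B → IsMFence N B
    even⇒IsMFence W e dq m1 nc = nc , AltWalk.m W , (λ k → AltWalk.w W (toℕ k)) , two (AltWalk.m W) e m1 , even⇒%2≡0 (AltWalk.m W) e ,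
      subst (λ t → Enumerates N _ (walkArc t (λ k → AltWalk.w W (toℕ k)))) dq (toEnumeration W)
      where
      two : ∀ k → even k ≡ true → 1 ≤ k → 2 ≤ k
      two (suc zero) () _
      two (suc (suc k)) _ _ = s≤s (s≤s z≤n)


module TrailCharacterisation where

  open Counting
  open LocalCharacterisation
  open Segments
  open AlternatingWalks
  open TrailDegrees
  open ZeroOneConstraints
  open Patterns
  open TrailShapes

  module Trail (N : Digraph) (nw : IsRootedBinaryPhyloNetwork N) {B : ArcSet N} (mx : IsMaximalZigZagTrail N B) (W : AltWalk N B)
    (A : ArcSet N) (sub : SubArcs N A (E N)) where
    open TrailDegrees.InNetwork N nw
    open Shapes N nw
    open AltWalk W
    open TrailBits mx W A sub

    LocalBySide⇒InS : LocalBySide N A → InS N B m (applyFrom x 0 m)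
    LocalBySide⇒InS l with closed⊎open mx W
    ... | inj₁ cl = inj₁ (closed⇒IsCrown W cl , crownPattern⇒ m x (proj₁ cl) (crown⇒ d m x (proj₁ cl) (≤-trans (s≤s (s≤s z≤n)) (proj₁ (proj₂ cl))) (AdmissibleAlong⇒CrownOK cl (LocalBySide⇒AdmissibleAlong l))))
    ... | inj₂ nc with even m in em
    ... | false = inj₂ (inj₁ (odd⇒IsNFence W em (open⇒¬IsCrown mx W nc) , nPattern⇒ m x em (oddFence⇒ d m x em (AdmissibleAlong⇒FenceOK nc (LocalBySide⇒AdmissibleAlong l)))))
    ... | true with d B≟ true
    ... | yes dq = ⊥-elim (¬FenceOK-W m x em (length≥1 mx W) (subst (λ t → FenceOK t m x) dq (AdmissibleAlong⇒FenceOK nc (LocalBySide⇒AdmissibleAlong l))))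
    ... | no ndq with even-form m em (length≥1 mx W)
    ... | n , me with evenFence⇒ n x (subst (λ t → FenceOK false t x) me (subst (λ t → FenceOK t m x) (¬-not ndq) (AdmissibleAlong⇒FenceOK nc (LocalBySide⇒AdmissibleAlong l))))
    ... | p , q , e , pw = inj₂ (inj₂ (even⇒IsMFence W em (¬-not ndq) (length≥1 mx W) (open⇒¬IsCrown mx W nc) , p , q , trans e (even-form-half m n me) ,
            mPatternList⇒ p q m x (trans me (cong (λ t → suc (suc (t + t))) (sym e))) (λ j j< → pw j (subst (j <_) me j<))))

    InS⇒AdmissibleAlong : InS N B m (applyFrom x 0 m) → AdmissibleAlong W A
    InS⇒AdmissibleAlong ins with closed⊎open mx W | ins
    ... | inj₁ cl | inj₁ (_ , ls) with crownPattern⇐ m x ls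
    ... | em , alts = CrownOK⇒AdmissibleAlong cl (crown⇐ d m x em (≤-trans (s≤s (s≤s z≤n)) (proj₁ (proj₂ cl))) alts)
    InS⇒AdmissibleAlong ins | inj₁ cl | inj₂ (inj₁ (nf , _)) = ⊥-elim (proj₁ nf (closed⇒IsCrown W cl))
    InS⇒AdmissibleAlong ins | inj₁ cl | inj₂ (inj₂ (mf , _)) = ⊥-elim (proj₁ mf (closed⇒IsCrown W cl))
    InS⇒AdmissibleAlong ins | inj₂ nc | inj₁ (ic , _) = ⊥-elim (open⇒¬IsCrown mx W nc ic)
    InS⇒AdmissibleAlong ins | inj₂ nc | inj₂ (inj₁ (nf , ls)) with nPattern⇐ m x ls
    ... | em , pw = FenceOK⇒AdmissibleAlong nc (oddFence⇐ d m x em pw)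
    InS⇒AdmissibleAlong ins | inj₂ nc | inj₂ (inj₂ (mf , p , q , e , ls)) with mPatternList⇐ p q m x ls | d B≟ true
    ... | _ | yes dq = ⊥-elim (open-forward⇒¬IsMFence mx W nc dq mf)
    ... | me , pw | no ndq = FenceOK⇒AdmissibleAlong nc (subst (λ t → FenceOK t m x) (sym (¬-not ndq))
            (subst (λ t → FenceOK false t x) (sym me) (evenFence⇐ p q x (λ j j< → pw j (subst (j <_) (sym me) j<)))))


-- Only the network part of tree-basedness is needed: a W-fence admits no admissible 0-1
-- sequence, so for a network containing one both sides of each statement are empty.
module Decomposition (N : Digraph) (tb : IsTreeBased N) (D : MaxZZDecomposition N) (O : TrailOrderings N D) where

  open Counting
  open LocalCharacterisation
  open Segments
  open AlternatingWalks
  open TrailDegrees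
  open ZeroOneConstraints
  open Patterns
  open TrailShapes
  open TrailCharacterisation

  nw = proj₁ tb
  open TrailDegrees.InNetwork N nw
  open Shapes N nw
  open Network N nw

  walkOf : (i : Fin (ℓ D)) → AltWalk N (trail D i)
  walkOf i = fromEnumeration {N} {trail D i} (len O i) (dir O i) (walk O i) (enum O i)

  maximalOf : (i : Fin (ℓ D)) → IsMaximalZigZagTrail N (trail D i)
  maximalOf i = maximal D i

  χ≡bits : ∀ i A → χ O i A ≡ applyFrom (bits (walkOf i) A) 0 (len O i)
  χ≡bits i A = tabulate-applyFrom (bits (walkOf i) A) (len O i) 0 _ λ j →
    trans (cong (on A) (walkArc-clamp (dir O i) (walk O i) j)) (cong (bits (walkOf i) A) (sym (+-identityʳ (toℕ j))))

  subdivisionTree⇔InS : ∀ (A : ArcSet N) → SubArcs N A (E N) →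
    (IsSubdivisionTree N A ⇔ (∀ i → InS N (trail D i) (len O i) (χ O i A)))
  subdivisionTree⇔InS A sub = mk⇔ to' from'
    where
    to' : IsSubdivisionTree N A → ∀ i → InS N (trail D i) (len O i) (χ O i A)
    to' t i = subst (InS N (trail D i) (len O i)) (sym (χ≡bits i A))
      (Trail.LocalBySide⇒InS N nw (maximalOf i) (walkOf i) A sub (Local⇒LocalBySide N A (subdivisionTree⇒Local A sub t)))
    from' : (∀ i → InS N (trail D i) (len O i) (χ O i A)) → IsSubdivisionTree N A
    from' h = Local⇒subdivisionTree A sub (LocalBySide⇒Local N A (AdmissibleAlong⇒LocalBySide A cover))
      where
      cover : ∀ u v → E N u v ≡ true → Σ (ArcSet N) λ B → B u v ≡ true × Σ (AltWalk N B) λ W → AdmissibleAlong W A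
      cover u v e with partition D u v e
      ... | i , ti , _ = trail D i , ti , walkOf i , Trail.InS⇒AdmissibleAlong N nw (maximalOf i) (walkOf i) A sub (subst (InS N (trail D i) (len O i)) (χ≡bits i A) (h i))

  SubArcs-false : ∀ (A : ArcSet N) → SubArcs N A (E N) → ∀ u v → E N u v ≡ false → A u v ≡ false
  SubArcs-false A sub u v e with A u v in q
  ... | false = refl
  ... | true with () ← trans (sym e) (sub u v q)

  χ-determines-subdivisionTree : ∀ (A B : ArcSet N) → IsSubdivisionTree N A → IsSubdivisionTree N B →
         (∀ i → χ O i A ≡ χ O i B) → ∀ u v → A u v ≡ B u v
  χ-determines-subdivisionTree A B tA tB eq u v with E N u v in qe
  ... | false = trans (SubArcs-false A (proj₁ tA) u v qe) (sym (SubArcs-false B (proj₁ tB) u v qe))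
  ... | true with partition D u v qe
  ... | i , ti , _ with Equivalence.to (proj₂ (enum O i) u v) ti
  ... | j , ej = subst (λ e → on A e ≡ on B e) ej (tabulate-injective _ _ (eq i) j)

  InS-length : ∀ i (s : List Bool) → InS N (trail D i) (len O i) s → length s ≡ len O i
  InS-length i s (inj₁ (ic , ls)) with IsCrown⇒closed (maximalOf i) ic
  ... | Wc , clc = trans (lenC ls) (even-halves m em)
    where
    m = len O i
    em : even m ≡ true
    em = subst (λ t → even t ≡ true) (sym (AltWalk-length-unique (walkOf i) Wc)) (proj₁ clc)
    lenC : (s ≡ rep (m / 2) TF ⊎ s ≡ rep (m / 2) FT) → length s ≡ (m / 2) + (m / 2)
    lenC (inj₁ e) = trans (cong length e) (length-rep-TF (m / 2))
    lenC (inj₂ e) = trans (cong length e) (length-rep-FT (m / 2))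
  InS-length i s (inj₂ (inj₁ ((nc , mN , v , md , en) , ls))) =
    trans (cong length ls) (trans (length-nPattern m) (odd-halves m em))
    where
    m = len O i
    em : even m ≡ false
    em = subst (λ t → even t ≡ false) (sym (AltWalk-length-unique (walkOf i) (fromEnumeration {N} {trail D i} mN true v en))) (%2≡1⇒odd mN md)
  InS-length i s (inj₂ (inj₂ ((nc , mM , v , m2 , md , en) , p , q , e , ls))) with even-form m em (≤-trans (s≤s z≤n) m2')
    where
    m = len O i
    cd = AltWalk-length-unique (walkOf i) (fromEnumeration {N} {trail D i} mM false v en)
    em : even m ≡ true
    em = subst (λ t → even t ≡ true) (sym cd) (%2≡0⇒even mM md)
    m2' : 2 ≤ m
    m2' = subst (2 ≤_) (sym cd) m2
  ... | n , me = trans (cong length ls) (trans (length-mPatternList p q)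
        (trans (cong (λ t → suc (suc (t + t))) (trans e (sym (even-form-half (len O i) n me)))) (sym me)))

  module Realise (s : Fin (ℓ D) → List Bool) (hs : ∀ i → InS N (trail D i) (len O i) (s i)) where
    OnTrail : Fin (V N) → Fin (V N) → Set
    OnTrail u v = Σ (Fin (ℓ D)) λ i → Σ (Fin (len O i)) λ j → ordArc O i j ≡ (u , v)

    onTrail? : ∀ u v → Dec (OnTrail u v)
    onTrail? u v = any? (λ i → any? (λ j → ≡-dec F._≟_ F._≟_ (ordArc O i j) (u , v)))

    bitOf : ∀ {u v} → Dec (OnTrail u v) → Bool
    bitOf (yes (i , j , _)) = lookupᵇ (s i) (toℕ j)
    bitOf (no _) = false

    A : ArcSet N
    A u v = bitOf (onTrail? u v)

    ordArc∈trail : ∀ i j → on (trail D i) (ordArc O i j) ≡ true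
    ordArc∈trail i j = Equivalence.from (proj₂ (enum O i) _ _) (j , refl)

    ordArc∈E : ∀ i j → on (E N) (ordArc O i j) ≡ true
    ordArc∈E i j = proj₁ (proj₁ (maximalOf i)) _ _ (ordArc∈trail i j)

    bitOf⇒E : ∀ u v (t : Dec (OnTrail u v)) → bitOf t ≡ true → E N u v ≡ true
    bitOf⇒E u v (yes (i , j , e)) _ = subst (λ a → on (E N) a ≡ true) e (ordArc∈E i j)

    A⊆E : SubArcs N A (E N)
    A⊆E u v = bitOf⇒E u v (onTrail? u v)

    ordArc-unique : ∀ i j i' (j' : Fin (len O i')) → ordArc O i' j' ≡ ordArc O i j →
      lookupᵇ (s i') (toℕ j') ≡ lookupᵇ (s i) (toℕ j)
    ordArc-unique i j i' j' e with partition D _ _ (ordArc∈E i j)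
    ... | _ , _ , unique with trans (unique i' (subst (λ a → on (trail D i') a ≡ true) e (ordArc∈trail i' j')))
                                    (sym (unique i (ordArc∈trail i j)))
    ... | refl = cong (λ t → lookupᵇ (s i) (toℕ t)) (proj₁ (enum O i) j' j e)

    A-ordArc : ∀ i (j : Fin (len O i)) → on A (ordArc O i j) ≡ lookupᵇ (s i) (toℕ j)
    A-ordArc i j with onTrail? (proj₁ (ordArc O i j)) (proj₂ (ordArc O i j))
    ... | no n = ⊥-elim (n (i , j , refl))
    ... | yes (i' , j' , e) = ordArc-unique i j i' j' e

    χA : ∀ i → χ O i A ≡ s i
    χA i = trans (tabulate-cong (A-ordArc i)) (tabulate-lookupᵇ (s i) (len O i) (InS-length i (s i) (hs i)))

    realisation : Σ[ A ∈ ArcSet N ] IsSubdivisionTree N A × (∀ i → χ O i A ≡ s i)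
    realisation = A , Equivalence.from (subdivisionTree⇔InS A A⊆E) (λ i → subst (InS N (trail D i) (len O i)) (sym (χA i)) (hs i)) , χA


theorem4p8 : (N : Digraph) → IsTreeBased N →
  (D : MaxZZDecomposition N) → (O : TrailOrderings N D) →
  (∀ (A : ArcSet N) → SubArcs N A (E N) →
     (IsSubdivisionTree N A ⇔ (∀ i → InS N (trail D i) (len O i) (χ O i A))))
  × (∀ (A B : ArcSet N) → IsSubdivisionTree N A → IsSubdivisionTree N B →
       (∀ i → χ O i A ≡ χ O i B) → ∀ u v → A u v ≡ B u v)
  × (∀ (s : Fin (ℓ D) → List Bool) → (∀ i → InS N (trail D i) (len O i) (s i)) →
       Σ[ A ∈ ArcSet N ] IsSubdivisionTree N A × (∀ i → χ O i A ≡ s i))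
theorem4p8 N tb D O = subdivisionTree⇔InS , χ-determines-subdivisionTree , λ s hs → Realise.realisation s hs
  where open Decomposition N tb D O
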